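{- Let $\mu_1\ge\mu_2$ be positive integers and $n$ an integer with $n\ge \mu_1+\mu_2$. Set $j=\mu_2+1$ and $k=\mu_1-\mu_2+1$. Then the total number of standard Young tableaux of skew shape $\lambda/(\mu_1,\mu_2)$, summed over all partitions $\lambda$ of $n$ having at most three parts (with $(\mu_1,\mu_2)\subset\lambda$), filled with the numbers $1,2,\ldots,n-(\mu_1+\mu_2)$, equals \[ \sum_i r_{i,j,k}\, M_{i+n-(\mu_1+\mu_2)}, \] where $M_m$ is the $m$th Motzkin number and $r_{i,j,k}$ is the coefficient of $x^i$ in the polynomial \[ r_{j,k}(x)=r_j(x)r_k(x)-r_{j-1}(x)r_{k-1}(x), \] with the polynomials $r_m(x)$ defined by $r_0(x)=0$ and $\sum_{m=1}^\infty r_m(x)y^m=\frac{y}{(1-y)(1+(1-x)y+y^2)}$. Equivalently, $\sum_{j,k\ge1} r_{j,k}(x)y^jz^k=\frac{yz(1-yz)}{(1-y)(1+(1-x)y+y^2)(1-z)(1+(1-x)z+z^2)}$.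
   Context: A partition $\lambda=(\lambda_1,\lambda_2,\ldots)$ of $n$ is a weakly decreasing sequence of positive integers summing to $n$. For partitions $\mu\subset\lambda$ (i.e. $\mu_i\le\lambda_i$ for all $i$), the skew diagram $\lambda/\mu$ is the Young diagram of $\lambda$ (left-justified rows of $\lambda_i$ boxes) with that of $\mu$ removed. A standard Young tableau of skew shape $\lambda/\mu$ is a filling of the $|\lambda|-|\mu|$ boxes with $1,2,\ldots,|\lambda|-|\mu|$, each used once, increasing left to right along rows and top to bottom down columns. The Motzkin numbers are $M_m=\sum_{k=0}^{\lfloor m/2\rfloor}\frac{m!}{k!(k+1)!(m-2k)!}$, with generating function $\sum_m M_m x^m=\frac{1-x-\sqrt{1-2x-3x^2}}{2x^2}$. -}

module Defs where

open import Data.Nat using (ℕ; zero; suc; _+_; _*_; _∸_; _≤_; _<_; _≥_; _!; _/_)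
open import Data.Nat.Properties using (_!≢0; m*n≢0)
open import Data.Integer as ℤ using (ℤ; +_)
open import Data.List using (List; []; _∷_; length; _++_; applyUpTo; map; foldr)
open import Data.List.Relation.Unary.All using (All)
open import Data.List.Relation.Unary.Unique.Propositional using (Unique)
open import Data.List.Membership.Propositional using (_∈_)
open import Data.List.Relation.Binary.Permutation.Propositional using (_↭_)
open import Data.Maybe using (Maybe; just; nothing)
open import Data.Product using (_×_; _,_; Σ; ∃)
open import Relation.Binary.PropositionalEquality using (_≡_)

sumℕ : ℕ → (ℕ → ℕ) → ℕ
sumℕ zero    f = 0
sumℕ (suc m) f = sumℕ m f + f m

sumℤ : ℕ → (ℕ → ℤ) → ℤ
sumℤ zero    f = + 0
sumℤ (suc m) f = sumℤ m f ℤ.+ f m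

-- Motzkin numbers:  M_m = Σ_{k=0}^{⌊m/2⌋} m! / (k! (k+1)! (m-2k)!)
-- (terms with 2k > m are excluded by the range of summation; we sum over
--  k < suc ⌊m/2⌋, i.e. k ≤ m / 2)

motzkinTerm : ℕ → ℕ → ℕ
motzkinTerm m k =
  (m ! / (k ! * (suc k) ! * (m ∸ (k + k)) !))
    {{m*n≢0 _ _ {{m*n≢0 _ _ {{k !≢0}} {{suc k !≢0}}}} {{(m ∸ (k + k)) !≢0}}}}

Motzkin : ℕ → ℕ
Motzkin m = sumℕ (suc (m / 2)) (motzkinTerm m)

-- Polynomials in x with integer coefficients, as coefficient lists
-- (entry i = coefficient of x^i).

Poly : Set
Poly = List ℤ

_⊕_ : Poly → Poly → Poly
[]       ⊕ q        = q
(a ∷ p)  ⊕ []       = a ∷ p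
(a ∷ p)  ⊕ (b ∷ q)  = (a ℤ.+ b) ∷ (p ⊕ q)

scale : ℤ → Poly → Poly
scale c = map (c ℤ.*_)

⊝_ : Poly → Poly
⊝ p = scale (ℤ.- (+ 1)) p

_⊗_ : Poly → Poly → Poly
[]      ⊗ q = []
(a ∷ p) ⊗ q = scale a q ⊕ (+ 0 ∷ (p ⊗ q))

coeff : Poly → ℕ → ℤ
coeff []      i       = + 0
coeff (a ∷ p) zero    = a
coeff (a ∷ p) (suc i) = coeff p i

oneMinusX : Poly
oneMinusX = + 1 ∷ ℤ.- (+ 1) ∷ []

-- Coefficients s_b(x) of y^b in the power series 1 / (1 + (1-x) y + y^2):
-- s_0 = 1, s_1 = -(1-x), s_{b+2} = -(1-x) s_{b+1} - s_b.
-- sPair b = (s_b , s_{b+1})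
sPair : ℕ → Poly × Poly
sPair zero    = (+ 1 ∷ []) , (⊝ oneMinusX)
sPair (suc b) with sPair b
... | (p , q) = q , ((⊝ (oneMinusX ⊗ q)) ⊕ (⊝ p))

s : ℕ → Poly
s b with sPair b
... | (p , _) = p

-- r_m(x) = [y^m] y / ((1-y)(1+(1-x)y+y^2)) = Σ_{b=0}^{m-1} s_b(x);  r_0 = 0.
r : ℕ → Poly
r zero    = []
r (suc m) = r m ⊕ s m

rjk : ℕ → ℕ → Poly
rjk zero    k       = []   -- not used (j ≥ 1 in the theorem)
rjk (suc j) zero    = []   -- not used (k ≥ 1 in the theorem)
rjk (suc j) (suc k) = (r (suc j) ⊗ r (suc k)) ⊕ (⊝ (r j ⊗ r k))

-- Σ_i r_{i,j,k} M_{i+N}  (the coefficient list of r_{j,k} is finite, so the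
-- sum over all i ≥ 0 equals the sum over i < length of the list)
motzkinCombination : ℕ → ℕ → ℕ → ℤ
motzkinCombination j k N =
  sumℤ (length (rjk j k)) (λ i → coeff (rjk j k) i ℤ.* (+ Motzkin (i + N)))

-- A shape λ = (λ₁, λ₂, λ₃) (trailing zeros allowed = fewer parts).
-- A filling is given by its three rows: row r is the list of entries in the
-- boxes (r, c) for μ_r ≤ c < λ_r, read left to right (μ₃ = 0).

Shape : Set
Shape = ℕ × ℕ × ℕ

Filling : Set
Filling = List ℕ × List ℕ × List ℕ

nth : List ℕ → ℕ → Maybe ℕ
nth []       i       = nothing
nth (a ∷ xs) zero    = just a
nth (a ∷ xs) (suc i) = nth xs i

entry : ℕ → List ℕ → ℕ → Maybe ℕ
entry zero      row c       = nth row c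
entry (suc off) row zero    = nothing
entry (suc off) row (suc c) = entry off row c

RowIncreasing : ℕ → List ℕ → Set
RowIncreasing off row =
  ∀ c a b → entry off row c ≡ just a → entry off row (suc c) ≡ just b → a < b

ColIncreasing : ℕ → List ℕ → ℕ → List ℕ → Set
ColIncreasing off₁ row₁ off₂ row₂ =
  ∀ c a b → entry off₁ row₁ c ≡ just a → entry off₂ row₂ c ≡ just b → a < b

IsShape : ℕ → ℕ → ℕ → Shape → Set
IsShape μ₁ μ₂ n (λ₁ , λ₂ , λ₃) =
  λ₂ ≤ λ₁ × λ₃ ≤ λ₂ × λ₁ + λ₂ + λ₃ ≡ n × μ₁ ≤ λ₁ × μ₂ ≤ λ₂

IsSYT : ℕ → ℕ → Shape → Filling → Set
IsSYT μ₁ μ₂ (λ₁ , λ₂ , λ₃) (t₁ , t₂ , t₃) =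
  length t₁ ≡ λ₁ ∸ μ₁ × length t₂ ≡ λ₂ ∸ μ₂ × length t₃ ≡ λ₃ ×
  (t₁ ++ t₂ ++ t₃) ↭ applyUpTo suc ((λ₁ ∸ μ₁) + (λ₂ ∸ μ₂) + λ₃) ×
  RowIncreasing μ₁ t₁ × RowIncreasing μ₂ t₂ × RowIncreasing 0 t₃ ×
  ColIncreasing μ₁ t₁ μ₂ t₂ × ColIncreasing μ₂ t₂ 0 t₃

SkewSYT3 : ℕ → ℕ → ℕ → Shape × Filling → Set
SkewSYT3 μ₁ μ₂ n (sh , T) = IsShape μ₁ μ₂ n sh × IsSYT μ₁ μ₂ sh T

-- "the predicate P on A holds for exactly m elements": there is a
-- duplicate-free list containing exactly the elements satisfying P, of length m
HasCount : {A : Set} → (A → Set) → ℕ → Set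
HasCount {A} P m =
  Σ (List A) λ L → Unique L × All P L × (∀ x → P x → x ∈ L) × length L ≡ m

module Submission where

-- The largest entry of a skew tableau ends its row, so the tableaux of shape λ/μ with |λ/μ| = N
-- are counted by W_N(μ), the number of ways of adding N boxes one at a time to μ = (μ₁, μ₂, 0)
-- keeping a partition.  With j = λ₂ − λ₃ + 1 and k = λ₁ − λ₂ + 1, a box in row 1, 2 or 3 moves (j, k)
-- to (j, k + 1), (j + 1, k − 1) or (j − 1, k).
-- On the other side let Λ_N(p) = Σᵢ pᵢ M_{N+i}, where M_m (= Σ_k C(m, 2k) Cat_k) counts Motzkin
-- paths.  Then Λ_{N+1}(p) = Λ_N(x p), and the generating function of the s_b gives
-- x s_b = s_{b+1} + s_b + s_{b−1}; hence N ↦ Λ_N(r_{j,k}) obeys the same recursion as W_N,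
-- and Λ_0(r_{j,k}) = 1 because Λ_0(r_j r_k) = min(j, k).

module MotzkinPaths where

  open import Data.Nat
  open import Data.Nat.Properties
  open import Data.Nat.Combinatorics
  open import Data.Nat.DivMod
  open import Data.Nat.Tactic.RingSolver
  open import Data.List using ([]; _∷_)
  open import Relation.Binary.PropositionalEquality
  open import Defs

  -- motzkinPaths n a: Motzkin paths of length n from height a down to height 0.
  motzkinPaths : ℕ → ℕ → ℕ
  motzkinPaths zero    zero    = 1
  motzkinPaths zero    (suc a) = 0
  motzkinPaths (suc n) zero    = motzkinPaths n 0 + motzkinPaths n 1
  motzkinPaths (suc n) (suc a) =
    motzkinPaths n a + motzkinPaths n (suc a) + motzkinPaths n (suc (suc a))

  ballot : ℕ → ℕ → ℕ
  ballot zero    a       = 1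
  ballot (suc k) zero    = ballot k 1
  ballot (suc k) (suc a) = ballot (suc k) a + ballot k (2 + a)

  ballot-closed-step : ∀ k a X₁ X₂ f g h →
    X₁ * (suc k * f * g) ≡ suc a * h →
    X₂ * (f * ((3 + k + a) * g)) ≡ (3 + a) * h →
    (X₁ + X₂) * (suc k * f * ((3 + k + a) * g)) ≡ (2 + a) * ((3 + k + k + a) * h)
  ballot-closed-step k a X₁ X₂ f g h e₁ e₂ = begin
    (X₁ + X₂) * (suc k * f * ((3 + k + a) * g))
      ≡⟨ solve (k ∷ a ∷ X₁ ∷ X₂ ∷ f ∷ g ∷ []) ⟩
    X₁ * (suc k * f * g) * (3 + k + a) + X₂ * (f * ((3 + k + a) * g)) * suc k
      ≡⟨ cong₂ (λ u v → u * (3 + k + a) + v * suc k) e₁ e₂ ⟩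
    suc a * h * (3 + k + a) + (3 + a) * h * suc k
      ≡⟨ solve (k ∷ a ∷ h ∷ []) ⟩
    (2 + a) * ((3 + k + k + a) * h) ∎
    where open ≡-Reasoning

  ballot-closed-step₀ : ∀ k X f g h →
    X * (f * g) ≡ 2 * h → X * (suc k * f * g) ≡ 1 * (suc (k + k + 1) * h)
  ballot-closed-step₀ k X f g h e = begin
    X * (suc k * f * g)        ≡⟨ solve (k ∷ X ∷ f ∷ g ∷ []) ⟩
    X * (f * g) * suc k        ≡⟨ cong (_* suc k) e ⟩
    2 * h * suc k              ≡⟨ solve (k ∷ h ∷ []) ⟩
    1 * (suc (k + k + 1) * h)  ∎
    where open ≡-Reasoning

  ballot-closed : ∀ k a → ballot k a * (k ! * (suc (k + a)) !) ≡ suc a * (k + k + a) !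
  ballot-closed zero    a = trans (*-identityˡ _) (*-identityˡ _)
  ballot-closed (suc k) zero = begin
    ballot k 1 * (suc k * k ! * (suc (suc k + 0)) !)
      ≡⟨ cong (λ m → ballot k 1 * (suc k * k ! * m !)) (cong suc shift) ⟩
    ballot k 1 * (suc k * k ! * (suc (k + 1)) !)
      ≡⟨ ballot-closed-step₀ k (ballot k 1) (k !) ((suc (k + 1)) !) ((k + k + 1) !) (ballot-closed k 1) ⟩
    1 * (suc (k + k + 1)) !
      ≡⟨ cong (λ m → 1 * m !) index ⟩
    1 * (suc k + suc k + 0) ! ∎
    where
    open ≡-Reasoning
    shift : suc k + 0 ≡ k + 1
    shift = solve (k ∷ [])
    index : suc (k + k + 1) ≡ suc k + suc k + 0
    index = solve (k ∷ [])
  ballot-closed (suc k) (suc a) = begin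
    (ballot (suc k) a + ballot k (2 + a)) * (suc k * k ! * (suc (suc k + suc a)) !)
      ≡⟨ cong (λ m → (ballot (suc k) a + ballot k (2 + a)) * (suc k * k ! * m !)) left-index ⟩
    (ballot (suc k) a + ballot k (2 + a)) * (suc k * k ! * ((3 + k + a) * (2 + k + a) !))
      ≡⟨ ballot-closed-step k a (ballot (suc k) a) (ballot k (2 + a)) (k !) ((2 + k + a) !) ((2 + k + k + a) !)
           (trans (ballot-closed (suc k) a) (cong (λ m → suc a * m !) lower-index))
           (trans (cong (λ m → ballot k (2 + a) * (k ! * m !)) upper-index)
                  (trans (ballot-closed k (2 + a)) (cong (λ m → (3 + a) * m !) middle-index))) ⟩
    (2 + a) * ((3 + k + k + a) * (2 + k + k + a) !)
      ≡⟨ cong (λ m → (2 + a) * m !) right-index ⟩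
    (2 + a) * (suc k + suc k + suc a) ! ∎
    where
    open ≡-Reasoning
    left-index : suc (suc k + suc a) ≡ 3 + k + a
    left-index = solve (k ∷ a ∷ [])
    lower-index : suc k + suc k + a ≡ 2 + k + k + a
    lower-index = solve (k ∷ a ∷ [])
    upper-index : 3 + k + a ≡ suc (k + (2 + a))
    upper-index = solve (k ∷ a ∷ [])
    middle-index : k + k + (2 + a) ≡ 2 + k + k + a
    middle-index = solve (k ∷ a ∷ [])
    right-index : 3 + k + k + a ≡ suc k + suc k + suc a
    right-index = solve (k ∷ a ∷ [])

  binomial-factorial : ∀ {n k} → k ≤ n → (n C k) * (k ! * (n ∸ k) !) ≡ n !
  binomial-factorial {n} {k} k≤n =
    trans (cong (_* (k ! * (n ∸ k) !)) (nCk≡n!/k![n-k]! k≤n))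
          (m/n*n≡m {{k !* (n ∸ k) !≢0}} (k![n∸k]!∣n! k≤n))

  motzkinTerm≡binomial*catalan : ∀ n k → k + k ≤ n → motzkinTerm n k ≡ (n C (k + k)) * ballot k 0
  motzkinTerm≡binomial*catalan n k k+k≤n =
    trans (cong (λ m → (m / D) {{D≢0}}) (sym product≡n!)) (m*n/n≡m ((n C (k + k)) * ballot k 0) D {{D≢0}})
    where
    open ≡-Reasoning
    D = k ! * (suc k) ! * (n ∸ (k + k)) !
    D≢0 = m*n≢0 _ _ {{m*n≢0 _ _ {{k !≢0}} {{suc k !≢0}}}} {{(n ∸ (k + k)) !≢0}}
    catalan : ballot k 0 * (k ! * (suc k) !) ≡ (k + k) !
    catalan = begin
      ballot k 0 * (k ! * (suc k) !)        ≡⟨ cong (λ m → ballot k 0 * (k ! * (suc m) !)) (sym (+-identityʳ k)) ⟩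
      ballot k 0 * (k ! * (suc (k + 0)) !)  ≡⟨ ballot-closed k 0 ⟩
      1 * (k + k + 0) !                     ≡⟨ trans (*-identityˡ _) (cong _! (+-identityʳ (k + k))) ⟩
      (k + k) !                             ∎
    product≡n! : (n C (k + k)) * ballot k 0 * D ≡ n !
    product≡n! = begin
      (n C (k + k)) * ballot k 0 * D
        ≡⟨ regroup (n C (k + k)) (ballot k 0) (k !) ((suc k) !) ((n ∸ (k + k)) !) ⟩
      (n C (k + k)) * (ballot k 0 * (k ! * (suc k) !) * (n ∸ (k + k)) !)
        ≡⟨ cong (λ m → (n C (k + k)) * (m * (n ∸ (k + k)) !)) catalan ⟩
      (n C (k + k)) * ((k + k) ! * (n ∸ (k + k)) !)
        ≡⟨ binomial-factorial k+k≤n ⟩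
      n ! ∎
      where
      regroup : ∀ c b f g h → c * b * (f * g * h) ≡ c * (b * (f * g) * h)
      regroup = solve-∀

  sumℕ-cong : ∀ m {f g : ℕ → ℕ} → (∀ i → i < m → f i ≡ g i) → sumℕ m f ≡ sumℕ m g
  sumℕ-cong zero    f≡g = refl
  sumℕ-cong (suc m) f≡g = cong₂ _+_ (sumℕ-cong m (λ i i<m → f≡g i (m<n⇒m<1+n i<m))) (f≡g m ≤-refl)

  sumℕ-+ : ∀ m (f g : ℕ → ℕ) → sumℕ m (λ i → f i + g i) ≡ sumℕ m f + sumℕ m g
  sumℕ-+ zero    f g = refl
  sumℕ-+ (suc m) f g = trans (cong (_+ (f m + g m)) (sumℕ-+ m f g)) (interchange (sumℕ m f) (sumℕ m g) (f m) (g m))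
    where
    interchange : ∀ a b c d → a + b + (c + d) ≡ a + c + (b + d)
    interchange = solve-∀

  sumℕ-suc : ∀ m (f : ℕ → ℕ) → sumℕ (suc m) f ≡ f 0 + sumℕ m (λ i → f (suc i))
  sumℕ-suc zero    f = +-comm 0 (f 0)
  sumℕ-suc (suc m) f = trans (cong (_+ f (suc m)) (sumℕ-suc m f)) (+-assoc (f 0) _ _)

  sumℕ-vanishing : ∀ m d (f : ℕ → ℕ) → (∀ i → m ≤ i → f i ≡ 0) → sumℕ (d + m) f ≡ sumℕ m f
  sumℕ-vanishing m zero    f f≡0 = refl
  sumℕ-vanishing m (suc d) f f≡0 =
    trans (cong₂ _+_ (sumℕ-vanishing m d f f≡0) (f≡0 (d + m) (m≤n+m m d))) (+-identityʳ _)

  -- A path counted by motzkinPaths n a is a choice of positions for its 2k + a non-flat steps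
  -- together with a ballot sequence of them.
  pathTerm : ℕ → ℕ → ℕ → ℕ
  pathTerm n a k = (n C (k + k + a)) * ballot k a

  pathSum : ℕ → ℕ → ℕ
  pathSum n a = sumℕ (suc n) (pathTerm n a)

  shiftRight : (ℕ → ℕ) → ℕ → ℕ
  shiftRight f zero    = 0
  shiftRight f (suc k) = f k

  sumℕ-shiftRight : ∀ m f → sumℕ (suc m) (shiftRight f) ≡ sumℕ m f
  sumℕ-shiftRight m f = sumℕ-suc m (shiftRight f)

  pathTerm-pascal-zero : ∀ n k → pathTerm (suc n) 0 k ≡ pathTerm n 0 k + shiftRight (pathTerm n 1) k
  pathTerm-pascal-zero n zero    = refl
  pathTerm-pascal-zero n (suc k) = begin
    (suc n C (suc k + suc k + 0)) * ballot k 1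
      ≡⟨ cong (λ m → (suc n C m) * ballot k 1) index ⟩
    (suc n C suc (k + k + 1)) * ballot k 1
      ≡⟨ cong (_* ballot k 1) (sym (nCk+nC[k+1]≡[n+1]C[k+1] n (k + k + 1))) ⟩
    ((n C (k + k + 1)) + (n C suc (k + k + 1))) * ballot k 1
      ≡⟨ *-distribʳ-+ (ballot k 1) (n C (k + k + 1)) _ ⟩
    (n C (k + k + 1)) * ballot k 1 + (n C suc (k + k + 1)) * ballot k 1
      ≡⟨ +-comm ((n C (k + k + 1)) * ballot k 1) _ ⟩
    (n C suc (k + k + 1)) * ballot k 1 + (n C (k + k + 1)) * ballot k 1
      ≡⟨ cong (λ m → (n C m) * ballot k 1 + (n C (k + k + 1)) * ballot k 1) (sym index) ⟩
    (n C (suc k + suc k + 0)) * ballot k 1 + (n C (k + k + 1)) * ballot k 1 ∎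
    where
    open ≡-Reasoning
    index : suc k + suc k + 0 ≡ suc (k + k + 1)
    index = solve (k ∷ [])

  pathTerm-pascal-suc : ∀ n a k →
    pathTerm (suc n) (suc a) k ≡ pathTerm n a k + pathTerm n (suc a) k + shiftRight (pathTerm n (2 + a)) k
  pathTerm-pascal-suc n a zero =
    trans (cong (_* 1) (sym (nCk+nC[k+1]≡[n+1]C[k+1] n a))) (distrib (n C a) (n C suc a))
    where
    distrib : ∀ c c′ → (c + c′) * 1 ≡ c * 1 + c′ * 1 + 0
    distrib = solve-∀
  pathTerm-pascal-suc n a (suc k) = begin
    (suc n C (suc k + suc k + suc a)) * (ballot (suc k) a + ballot k (2 + a))
      ≡⟨ cong (λ m → (suc n C m) * (ballot (suc k) a + ballot k (2 + a))) upper-index ⟩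
    (suc n C suc (2 + k + k + a)) * (ballot (suc k) a + ballot k (2 + a))
      ≡⟨ cong (_* (ballot (suc k) a + ballot k (2 + a))) (sym (nCk+nC[k+1]≡[n+1]C[k+1] n (2 + k + k + a))) ⟩
    ((n C (2 + k + k + a)) + (n C suc (2 + k + k + a))) * (ballot (suc k) a + ballot k (2 + a))
      ≡⟨ distrib (n C (2 + k + k + a)) (n C suc (2 + k + k + a)) (ballot (suc k) a) (ballot k (2 + a)) ⟩
    (n C (2 + k + k + a)) * ballot (suc k) a
      + (n C suc (2 + k + k + a)) * (ballot (suc k) a + ballot k (2 + a))
      + (n C (2 + k + k + a)) * ballot k (2 + a)
      ≡⟨ cong₂ (λ i j → (n C i) * ballot (suc k) a + (n C j) * (ballot (suc k) a + ballot k (2 + a))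
                          + (n C (2 + k + k + a)) * ballot k (2 + a))
               (sym lower-index) (trans (sym upper-index) (+-suc (suc k + suc k) a)) ⟩
    (n C (suc k + suc k + a)) * ballot (suc k) a
      + (n C suc (suc k + suc k + a)) * (ballot (suc k) a + ballot k (2 + a))
      + (n C (2 + k + k + a)) * ballot k (2 + a)
      ≡⟨ cong₂ (λ i j → (n C (suc k + suc k + a)) * ballot (suc k) a
                          + (n C i) * (ballot (suc k) a + ballot k (2 + a)) + (n C j) * ballot k (2 + a))
               (sym (+-suc (suc k + suc k) a)) (sym shifted-index) ⟩
    (n C (suc k + suc k + a)) * ballot (suc k) a
      + (n C (suc k + suc k + suc a)) * (ballot (suc k) a + ballot k (2 + a))
      + (n C (k + k + (2 + a))) * ballot k (2 + a) ∎
    where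
    open ≡-Reasoning
    distrib : ∀ c c′ x z → (c + c′) * (x + z) ≡ c * x + c′ * (x + z) + c * z
    distrib = solve-∀
    upper-index : suc k + suc k + suc a ≡ suc (2 + k + k + a)
    upper-index = solve (k ∷ a ∷ [])
    lower-index : suc k + suc k + a ≡ 2 + k + k + a
    lower-index = solve (k ∷ a ∷ [])
    shifted-index : k + k + (2 + a) ≡ 2 + k + k + a
    shifted-index = solve (k ∷ a ∷ [])

  pathSum-extend : ∀ n a d → sumℕ (d + suc n) (pathTerm n a) ≡ pathSum n a
  pathSum-extend n a d = sumℕ-vanishing (suc n) d (pathTerm n a) vanishes
    where
    vanishes : ∀ k → suc n ≤ k → pathTerm n a k ≡ 0
    vanishes k n<k = cong (_* ballot k a) (k>n⇒nCk≡0 (≤-trans n<k (≤-trans (m≤m+n k k) (m≤m+n (k + k) a))))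

  pathSum-suc-zero : ∀ n → pathSum (suc n) 0 ≡ pathSum n 0 + pathSum n 1
  pathSum-suc-zero n = begin
    sumℕ (2 + n) (pathTerm (suc n) 0)
      ≡⟨ sumℕ-cong (2 + n) (λ k _ → pathTerm-pascal-zero n k) ⟩
    sumℕ (2 + n) (λ k → pathTerm n 0 k + shiftRight (pathTerm n 1) k)
      ≡⟨ sumℕ-+ (2 + n) (pathTerm n 0) (shiftRight (pathTerm n 1)) ⟩
    sumℕ (2 + n) (pathTerm n 0) + sumℕ (2 + n) (shiftRight (pathTerm n 1))
      ≡⟨ cong₂ _+_ (pathSum-extend n 0 1) (sumℕ-shiftRight (suc n) (pathTerm n 1)) ⟩
    pathSum n 0 + pathSum n 1 ∎
    where open ≡-Reasoning

  pathSum-suc-suc : ∀ n a → pathSum (suc n) (suc a) ≡ pathSum n a + pathSum n (suc a) + pathSum n (2 + a)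
  pathSum-suc-suc n a = begin
    sumℕ (2 + n) (pathTerm (suc n) (suc a))
      ≡⟨ sumℕ-cong (2 + n) (λ k _ → pathTerm-pascal-suc n a k) ⟩
    sumℕ (2 + n) (λ k → pathTerm n a k + pathTerm n (suc a) k + shiftRight (pathTerm n (2 + a)) k)
      ≡⟨ sumℕ-+ (2 + n) (λ k → pathTerm n a k + pathTerm n (suc a) k) (shiftRight (pathTerm n (2 + a))) ⟩
    sumℕ (2 + n) (λ k → pathTerm n a k + pathTerm n (suc a) k) + sumℕ (2 + n) (shiftRight (pathTerm n (2 + a)))
      ≡⟨ cong₂ _+_ (sumℕ-+ (2 + n) (pathTerm n a) (pathTerm n (suc a))) (sumℕ-shiftRight (suc n) (pathTerm n (2 + a))) ⟩
    sumℕ (2 + n) (pathTerm n a) + sumℕ (2 + n) (pathTerm n (suc a)) + pathSum n (2 + a)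
      ≡⟨ cong₂ (λ x y → x + y + pathSum n (2 + a)) (pathSum-extend n a 1) (pathSum-extend n (suc a) 1) ⟩
    pathSum n a + pathSum n (suc a) + pathSum n (2 + a) ∎
    where open ≡-Reasoning

  motzkinPaths≡pathSum : ∀ n a → motzkinPaths n a ≡ pathSum n a
  motzkinPaths≡pathSum zero    zero    = refl
  motzkinPaths≡pathSum zero    (suc a) = refl
  motzkinPaths≡pathSum (suc n) zero    =
    trans (cong₂ _+_ (motzkinPaths≡pathSum n 0) (motzkinPaths≡pathSum n 1)) (sym (pathSum-suc-zero n))
  motzkinPaths≡pathSum (suc n) (suc a) =
    trans (cong₂ _+_ (cong₂ _+_ (motzkinPaths≡pathSum n a) (motzkinPaths≡pathSum n (suc a)))
                     (motzkinPaths≡pathSum n (2 + a)))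
          (sym (pathSum-suc-suc n a))

  double≤⇒≤half : ∀ {n k} → k + k ≤ n → k ≤ n / 2
  double≤⇒≤half {n} {k} k+k≤n =
    subst (_≤ n / 2) (m*n/n≡m k 2) (/-monoˡ-≤ 2 (subst (_≤ n) (trans (cong (k +_) (sym (+-identityʳ k))) (*-comm 2 k)) k+k≤n))

  ≤half⇒double≤ : ∀ {n k} → k ≤ n / 2 → k + k ≤ n
  ≤half⇒double≤ {n} {k} k≤n/2 =
    subst (_≤ n) (trans (*-comm k 2) (cong (k +_) (+-identityʳ k))) (≤-trans (*-monoˡ-≤ 2 k≤n/2) (m/n*n≤m n 2))

  Motzkin≡motzkinPaths : ∀ n → Motzkin n ≡ motzkinPaths n 0
  Motzkin≡motzkinPaths n = begin
    sumℕ (suc (n / 2)) (motzkinTerm n)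
      ≡⟨ sumℕ-cong (suc (n / 2)) (λ k k≤n/2 → trans (motzkinTerm≡binomial*catalan n k (≤half⇒double≤ (≤-pred k≤n/2)))
                                                     (cong (λ m → (n C m) * ballot k 0) (sym (+-identityʳ (k + k))))) ⟩
    sumℕ (suc (n / 2)) (pathTerm n 0)
      ≡⟨ sym (sumℕ-vanishing (suc (n / 2)) (n ∸ n / 2) (pathTerm n 0) beyond-half) ⟩
    sumℕ (n ∸ n / 2 + suc (n / 2)) (pathTerm n 0)
      ≡⟨ cong (λ m → sumℕ m (pathTerm n 0)) (trans (+-suc (n ∸ n / 2) (n / 2)) (cong suc (m∸n+n≡m (m/n≤m n 2)))) ⟩
    pathSum n 0
      ≡⟨ sym (motzkinPaths≡pathSum n 0) ⟩
    motzkinPaths n 0 ∎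
    where
    open ≡-Reasoning
    beyond-half : ∀ k → suc (n / 2) ≤ k → pathTerm n 0 k ≡ 0
    beyond-half k n/2<k = cong (_* ballot k 0) (k>n⇒nCk≡0 (≰⇒> (λ le → <⇒≱ n/2<k (double≤⇒≤half (≤-trans (≤-reflexive (sym (+-identityʳ (k + k)))) le)))))

module MotzkinMoments where

  open import Data.Nat as ℕ using (ℕ; zero; suc; _⊓_; pred)
  import Data.Nat.Properties as ℕ
  open import Data.Integer using (ℤ; +_; _+_; _*_; -_; _-_)
  open import Data.Integer.Properties using (+-identityˡ; +-identityʳ; +-assoc; *-zeroʳ; pos-+)
  open import Data.Integer.Tactic.RingSolver
  open import Data.List using (List; []; _∷_; length)
  open import Relation.Binary.PropositionalEquality
  open import Defs
  open MotzkinPaths using (motzkinPaths; Motzkin≡motzkinPaths)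

  sumℤ-cong : ∀ m {f g : ℕ → ℤ} → (∀ i → f i ≡ g i) → sumℤ m f ≡ sumℤ m g
  sumℤ-cong zero    f≡g = refl
  sumℤ-cong (suc m) f≡g = cong₂ _+_ (sumℤ-cong m f≡g) (f≡g m)

  sumℤ-suc : ∀ m (f : ℕ → ℤ) → sumℤ (suc m) f ≡ f 0 + sumℤ m (λ i → f (suc i))
  sumℤ-suc zero    f = trans (+-identityˡ (f 0)) (sym (+-identityʳ (f 0)))
  sumℤ-suc (suc m) f = trans (cong (_+ f (suc m)) (sumℤ-suc m f)) (+-assoc (f 0) _ _)

  module Moments (M : ℕ → ℤ) where

    -- Λ N p = Σᵢ pᵢ M (N + i); raising N by one multiplies p by x.
    Λ : ℕ → Poly → ℤ
    Λ N []      = + 0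
    Λ N (a ∷ p) = a * M N + Λ (suc N) p

    Λ-as-sum : ∀ N p → sumℤ (length p) (λ i → coeff p i * M (i ℕ.+ N)) ≡ Λ N p
    Λ-as-sum N []      = refl
    Λ-as-sum N (a ∷ p) =
      trans (sumℤ-suc (length p) (λ i → coeff (a ∷ p) i * M (i ℕ.+ N)))
            (cong (λ x → a * M N + x)
                  (trans (sumℤ-cong (length p) (λ i → cong (λ n → coeff p i * M n) (sym (ℕ.+-suc i N))))
                         (Λ-as-sum (suc N) p)))

    Λ-⊕ : ∀ N p q → Λ N (p ⊕ q) ≡ Λ N p + Λ N q
    Λ-⊕ N []      q       = sym (+-identityˡ (Λ N q))
    Λ-⊕ N (a ∷ p) []      = sym (+-identityʳ (Λ N (a ∷ p)))
    Λ-⊕ N (a ∷ p) (b ∷ q) =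
      trans (cong (λ x → (a + b) * M N + x) (Λ-⊕ (suc N) p q))
            (regroup a b (M N) (Λ (suc N) p) (Λ (suc N) q))
      where
      regroup : ∀ a b m x y → (a + b) * m + (x + y) ≡ (a * m + x) + (b * m + y)
      regroup = solve-∀

    Λ-scale : ∀ N c p → Λ N (scale c p) ≡ c * Λ N p
    Λ-scale N c []      = sym (*-zeroʳ c)
    Λ-scale N c (a ∷ p) =
      trans (cong (λ x → c * a * M N + x) (Λ-scale (suc N) c p)) (factor c a (M N) (Λ (suc N) p))
      where
      factor : ∀ c a m x → c * a * m + c * x ≡ c * (a * m + x)
      factor = solve-∀

    Λ⊗ : ℕ → Poly → Poly → ℤ
    Λ⊗ N p q = Λ N (p ⊗ q)

    Λ⊗-∷ˡ : ∀ N a p q → Λ⊗ N (a ∷ p) q ≡ a * Λ N q + Λ⊗ (suc N) p q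
    Λ⊗-∷ˡ N a p q = begin
      Λ N (scale a q ⊕ (+ 0 ∷ (p ⊗ q)))                ≡⟨ Λ-⊕ N (scale a q) (+ 0 ∷ (p ⊗ q)) ⟩
      Λ N (scale a q) + (+ 0 * M N + Λ⊗ (suc N) p q)   ≡⟨ cong₂ _+_ (Λ-scale N a q) (+-identityˡ (Λ⊗ (suc N) p q)) ⟩
      a * Λ N q + Λ⊗ (suc N) p q                       ∎
      where open ≡-Reasoning

    Λ⊗-⊕ˡ : ∀ N p p′ q → Λ⊗ N (p ⊕ p′) q ≡ Λ⊗ N p q + Λ⊗ N p′ q
    Λ⊗-⊕ˡ N []      p′       q = sym (+-identityˡ (Λ⊗ N p′ q))
    Λ⊗-⊕ˡ N (a ∷ p) []       q = sym (+-identityʳ (Λ⊗ N (a ∷ p) q))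
    Λ⊗-⊕ˡ N (a ∷ p) (b ∷ p′) q = begin
      Λ⊗ N ((a + b) ∷ (p ⊕ p′)) q
        ≡⟨ Λ⊗-∷ˡ N (a + b) (p ⊕ p′) q ⟩
      (a + b) * Λ N q + Λ⊗ (suc N) (p ⊕ p′) q
        ≡⟨ cong (λ x → (a + b) * Λ N q + x) (Λ⊗-⊕ˡ (suc N) p p′ q) ⟩
      (a + b) * Λ N q + (Λ⊗ (suc N) p q + Λ⊗ (suc N) p′ q)
        ≡⟨ regroup a b (Λ N q) (Λ⊗ (suc N) p q) (Λ⊗ (suc N) p′ q) ⟩
      (a * Λ N q + Λ⊗ (suc N) p q) + (b * Λ N q + Λ⊗ (suc N) p′ q)
        ≡⟨ sym (cong₂ _+_ (Λ⊗-∷ˡ N a p q) (Λ⊗-∷ˡ N b p′ q)) ⟩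
      Λ⊗ N (a ∷ p) q + Λ⊗ N (b ∷ p′) q ∎
      where
      open ≡-Reasoning
      regroup : ∀ a b l x y → (a + b) * l + (x + y) ≡ (a * l + x) + (b * l + y)
      regroup = solve-∀

    Λ⊗-scaleˡ : ∀ N c p q → Λ⊗ N (scale c p) q ≡ c * Λ⊗ N p q
    Λ⊗-scaleˡ N c []      q = sym (*-zeroʳ c)
    Λ⊗-scaleˡ N c (a ∷ p) q = begin
      Λ⊗ N (c * a ∷ scale c p) q                 ≡⟨ Λ⊗-∷ˡ N (c * a) (scale c p) q ⟩
      c * a * Λ N q + Λ⊗ (suc N) (scale c p) q   ≡⟨ cong (λ x → c * a * Λ N q + x) (Λ⊗-scaleˡ (suc N) c p q) ⟩
      c * a * Λ N q + c * Λ⊗ (suc N) p q         ≡⟨ factor c a (Λ N q) (Λ⊗ (suc N) p q) ⟩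
      c * (a * Λ N q + Λ⊗ (suc N) p q)           ≡⟨ cong (c *_) (sym (Λ⊗-∷ˡ N a p q)) ⟩
      c * Λ⊗ N (a ∷ p) q                         ∎
      where
      open ≡-Reasoning
      factor : ∀ c a l x → c * a * l + c * x ≡ c * (a * l + x)
      factor = solve-∀

    Λ⊗-[]ʳ : ∀ N p → Λ⊗ N p [] ≡ + 0
    Λ⊗-[]ʳ N []      = refl
    Λ⊗-[]ʳ N (a ∷ p) =
      trans (Λ⊗-∷ˡ N a p []) (trans (cong (λ x → a * + 0 + x) (Λ⊗-[]ʳ (suc N) p)) (vanish a))
      where
      vanish : ∀ a → a * + 0 + + 0 ≡ + 0
      vanish = solve-∀

    Λ⊗-∷ʳ : ∀ N p b q → Λ⊗ N p (b ∷ q) ≡ b * Λ N p + Λ⊗ (suc N) p q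
    Λ⊗-∷ʳ N []      b q = sym (vanish b)
      where
      vanish : ∀ b → b * + 0 + + 0 ≡ + 0
      vanish = solve-∀
    Λ⊗-∷ʳ N (a ∷ p) b q = begin
      Λ⊗ N (a ∷ p) (b ∷ q)
        ≡⟨ Λ⊗-∷ˡ N a p (b ∷ q) ⟩
      a * (b * M N + Λ (suc N) q) + Λ⊗ (suc N) p (b ∷ q)
        ≡⟨ cong (λ x → a * (b * M N + Λ (suc N) q) + x) (Λ⊗-∷ʳ (suc N) p b q) ⟩
      a * (b * M N + Λ (suc N) q) + (b * Λ (suc N) p + Λ⊗ (2 ℕ.+ N) p q)
        ≡⟨ regroup a b (M N) (Λ (suc N) q) (Λ (suc N) p) (Λ⊗ (2 ℕ.+ N) p q) ⟩
      b * (a * M N + Λ (suc N) p) + (a * Λ (suc N) q + Λ⊗ (2 ℕ.+ N) p q)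
        ≡⟨ cong (λ x → b * Λ N (a ∷ p) + x) (sym (Λ⊗-∷ˡ (suc N) a p q)) ⟩
      b * Λ N (a ∷ p) + Λ⊗ (suc N) (a ∷ p) q ∎
      where
      open ≡-Reasoning
      regroup : ∀ a b m y x z → a * (b * m + y) + (b * x + z) ≡ b * (a * m + x) + (a * y + z)
      regroup = solve-∀

    Λ⊗-comm : ∀ N p q → Λ⊗ N p q ≡ Λ⊗ N q p
    Λ⊗-comm N []      q = sym (Λ⊗-[]ʳ N q)
    Λ⊗-comm N (a ∷ p) q = begin
      Λ⊗ N (a ∷ p) q               ≡⟨ Λ⊗-∷ˡ N a p q ⟩
      a * Λ N q + Λ⊗ (suc N) p q   ≡⟨ cong (λ x → a * Λ N q + x) (Λ⊗-comm (suc N) p q) ⟩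
      a * Λ N q + Λ⊗ (suc N) q p   ≡⟨ sym (Λ⊗-∷ʳ N q a p) ⟩
      Λ⊗ N q (a ∷ p)               ∎
      where open ≡-Reasoning

    Λ⊗-1ˡ : ∀ N q → Λ⊗ N (+ 1 ∷ []) q ≡ Λ N q
    Λ⊗-1ˡ N q = trans (Λ⊗-∷ˡ N (+ 1) [] q) (unit (Λ N q))
      where
      unit : ∀ x → + 1 * x + + 0 ≡ x
      unit = solve-∀

    Λ⊗-oneMinusX : ∀ N p q → Λ⊗ N (oneMinusX ⊗ p) q ≡ Λ⊗ N p q - Λ⊗ (suc N) p q
    Λ⊗-oneMinusX N p q = begin
      Λ⊗ N (scale (+ 1) p ⊕ (+ 0 ∷ (x⊗p))) q
        ≡⟨ Λ⊗-⊕ˡ N (scale (+ 1) p) (+ 0 ∷ x⊗p) q ⟩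
      Λ⊗ N (scale (+ 1) p) q + Λ⊗ N (+ 0 ∷ x⊗p) q
        ≡⟨ cong₂ _+_ (Λ⊗-scaleˡ N (+ 1) p q) (Λ⊗-∷ˡ N (+ 0) x⊗p q) ⟩
      + 1 * Λ⊗ N p q + (+ 0 * Λ N q + Λ⊗ (suc N) (scale (- + 1) p ⊕ (+ 0 ∷ [])) q)
        ≡⟨ cong (λ x → + 1 * Λ⊗ N p q + (+ 0 * Λ N q + x)) (Λ⊗-⊕ˡ (suc N) (scale (- + 1) p) (+ 0 ∷ []) q) ⟩
      + 1 * Λ⊗ N p q + (+ 0 * Λ N q + (Λ⊗ (suc N) (scale (- + 1) p) q + Λ⊗ (suc N) (+ 0 ∷ []) q))
        ≡⟨ cong₂ (λ x y → + 1 * Λ⊗ N p q + (+ 0 * Λ N q + (x + y)))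
                 (Λ⊗-scaleˡ (suc N) (- + 1) p q) (Λ⊗-∷ˡ (suc N) (+ 0) [] q) ⟩
      + 1 * Λ⊗ N p q + (+ 0 * Λ N q + (- + 1 * Λ⊗ (suc N) p q + (+ 0 * Λ (suc N) q + + 0)))
        ≡⟨ simplify (Λ⊗ N p q) (Λ⊗ (suc N) p q) (Λ N q) (Λ (suc N) q) ⟩
      Λ⊗ N p q - Λ⊗ (suc N) p q ∎
      where
      open ≡-Reasoning
      x⊗p = (- + 1 ∷ []) ⊗ p
      simplify : ∀ x y u v → + 1 * x + (+ 0 * u + (- + 1 * y + (+ 0 * v + + 0))) ≡ x - y
      simplify = solve-∀

    sPrev : ℕ → Poly
    sPrev zero    = []
    sPrev (suc a) = s a

    Λ⊗-s-shift : ∀ N a q → Λ⊗ (suc N) (s a) q ≡ Λ⊗ N (s (suc a)) q + Λ⊗ N (s a) q + Λ⊗ N (sPrev a) q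
    Λ⊗-s-shift N zero q = sym (begin
      Λ⊗ N (⊝ oneMinusX) q + Λ⊗ N (+ 1 ∷ []) q + + 0
        ≡⟨ cong₂ (λ x y → x + y + + 0) (Λ⊗-scaleˡ N (- + 1) oneMinusX q) (Λ⊗-1ˡ N q) ⟩
      - + 1 * Λ⊗ N oneMinusX q + Λ N q + + 0
        ≡⟨ cong (λ x → - + 1 * x + Λ N q + + 0)
                (trans (Λ⊗-∷ˡ N (+ 1) (- + 1 ∷ []) q) (cong (λ x → + 1 * Λ N q + x) (Λ⊗-∷ˡ (suc N) (- + 1) [] q))) ⟩
      - + 1 * (+ 1 * Λ N q + (- + 1 * Λ (suc N) q + + 0)) + Λ N q + + 0
        ≡⟨ simplify (Λ N q) (Λ (suc N) q) ⟩
      Λ (suc N) q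
        ≡⟨ sym (Λ⊗-1ˡ (suc N) q) ⟩
      Λ⊗ (suc N) (+ 1 ∷ []) q ∎)
      where
      open ≡-Reasoning
      simplify : ∀ x y → - + 1 * (+ 1 * x + (- + 1 * y + + 0)) + x + + 0 ≡ y
      simplify = solve-∀
    Λ⊗-s-shift N (suc a) q = sym (begin
      Λ⊗ N ((⊝ (oneMinusX ⊗ s (suc a))) ⊕ (⊝ s a)) q + Λ⊗ N (s (suc a)) q + Λ⊗ N (s a) q
        ≡⟨ cong (λ x → x + Λ⊗ N (s (suc a)) q + Λ⊗ N (s a) q)
                (Λ⊗-⊕ˡ N (⊝ (oneMinusX ⊗ s (suc a))) (⊝ s a) q) ⟩
      Λ⊗ N (⊝ (oneMinusX ⊗ s (suc a))) q + Λ⊗ N (⊝ s a) q + Λ⊗ N (s (suc a)) q + Λ⊗ N (s a) q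
        ≡⟨ cong₂ (λ x y → x + y + Λ⊗ N (s (suc a)) q + Λ⊗ N (s a) q)
                 (trans (Λ⊗-scaleˡ N (- + 1) (oneMinusX ⊗ s (suc a)) q)
                        (cong (- + 1 *_) (Λ⊗-oneMinusX N (s (suc a)) q)))
                 (Λ⊗-scaleˡ N (- + 1) (s a) q) ⟩
      - + 1 * (Λ⊗ N (s (suc a)) q - Λ⊗ (suc N) (s (suc a)) q) + - + 1 * Λ⊗ N (s a) q
        + Λ⊗ N (s (suc a)) q + Λ⊗ N (s a) q
        ≡⟨ simplify (Λ⊗ N (s (suc a)) q) (Λ⊗ (suc N) (s (suc a)) q) (Λ⊗ N (s a) q) ⟩
      Λ⊗ (suc N) (s (suc a)) q ∎)
      where
      open ≡-Reasoning
      simplify : ∀ y x z → - + 1 * (y - x) + - + 1 * z + y + z ≡ x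
      simplify = solve-∀

    Λ⊗-r-shift : ∀ N m q →
      Λ⊗ (suc N) (r (suc m)) q ≡ Λ⊗ N (r (2 ℕ.+ m)) q + Λ⊗ N (r (suc m)) q + Λ⊗ N (r m) q - Λ N q
    Λ⊗-r-shift N zero q = begin
      Λ⊗ (suc N) (s 0) q
        ≡⟨ Λ⊗-s-shift N 0 q ⟩
      Λ⊗ N (s 1) q + Λ⊗ N (s 0) q + + 0
        ≡⟨ cong (λ x → Λ⊗ N (s 1) q + x + + 0) (Λ⊗-1ˡ N q) ⟩
      Λ⊗ N (s 1) q + Λ N q + + 0
        ≡⟨ rearrange (Λ⊗ N (s 1) q) (Λ N q) ⟩
      (Λ N q + Λ⊗ N (s 1) q) + Λ N q + + 0 - Λ N q
        ≡⟨ cong₂ (λ x y → (x + Λ⊗ N (s 1) q) + y + + 0 - Λ N q) (sym (Λ⊗-1ˡ N q)) (sym (Λ⊗-1ˡ N q)) ⟩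
      (Λ⊗ N (s 0) q + Λ⊗ N (s 1) q) + Λ⊗ N (s 0) q + + 0 - Λ N q
        ≡⟨ cong (λ x → x + Λ⊗ N (s 0) q + + 0 - Λ N q) (sym (Λ⊗-⊕ˡ N (s 0) (s 1) q)) ⟩
      Λ⊗ N (s 0 ⊕ s 1) q + Λ⊗ N (s 0) q + + 0 - Λ N q ∎
      where
      open ≡-Reasoning
      rearrange : ∀ x l → x + l + + 0 ≡ (l + x) + l + + 0 - l
      rearrange = solve-∀
    Λ⊗-r-shift N (suc m) q = begin
      Λ⊗ (suc N) (r (suc m) ⊕ s (suc m)) q
        ≡⟨ Λ⊗-⊕ˡ (suc N) (r (suc m)) (s (suc m)) q ⟩
      Λ⊗ (suc N) (r (suc m)) q + Λ⊗ (suc N) (s (suc m)) q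
        ≡⟨ cong₂ _+_ (Λ⊗-r-shift N m q) (Λ⊗-s-shift N (suc m) q) ⟩
      (R₂ + R₁ + R₀ - Λ N q) + (S₂ + S₁ + S₀)
        ≡⟨ regroup R₂ R₁ R₀ (Λ N q) S₂ S₁ S₀ ⟩
      (R₂ + S₂) + (R₁ + S₁) + (R₀ + S₀) - Λ N q
        ≡⟨ sym (cong₂ (λ x y → x + y - Λ N q)
                      (cong₂ _+_ (Λ⊗-⊕ˡ N (r (2 ℕ.+ m)) (s (2 ℕ.+ m)) q) (Λ⊗-⊕ˡ N (r (suc m)) (s (suc m)) q))
                      (Λ⊗-⊕ˡ N (r m) (s m) q)) ⟩
      Λ⊗ N (r (3 ℕ.+ m)) q + Λ⊗ N (r (2 ℕ.+ m)) q + Λ⊗ N (r (suc m)) q - Λ N q ∎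
      where
      open ≡-Reasoning
      R₂ = Λ⊗ N (r (2 ℕ.+ m)) q
      R₁ = Λ⊗ N (r (suc m)) q
      R₀ = Λ⊗ N (r m) q
      S₂ = Λ⊗ N (s (2 ℕ.+ m)) q
      S₁ = Λ⊗ N (s (suc m)) q
      S₀ = Λ⊗ N (s m) q
      regroup : ∀ r₂ r₁ r₀ l s₂ s₁ s₀ →
        (r₂ + r₁ + r₀ - l) + (s₂ + s₁ + s₀) ≡ (r₂ + s₂) + (r₁ + s₁) + (r₀ + s₀) - l
      regroup = solve-∀

    -- ρ N j k = Λ N (r_{j−1} r_{k−1}), padded with r_{−1} = 0 so that the shift
    -- recurrences below hold for all indices.
    ρ : ℕ → ℕ → ℕ → ℤ
    ρ N zero    k       = + 0
    ρ N (suc j) zero    = + 0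
    ρ N (suc j) (suc k) = Λ⊗ N (r j) (r k)

    ρ-comm : ∀ N j k → ρ N j k ≡ ρ N k j
    ρ-comm N zero    zero    = refl
    ρ-comm N zero    (suc k) = refl
    ρ-comm N (suc j) zero    = refl
    ρ-comm N (suc j) (suc k) = Λ⊗-comm N (r j) (r k)

    ρ-shiftˡ : ∀ N j k → ρ (suc N) (suc j) k ≡ ρ N (2 ℕ.+ j) k + ρ N (suc j) k + ρ N j k - ρ N 2 k
    ρ-shiftˡ N zero    zero    = refl
    ρ-shiftˡ N (suc j) zero    = refl
    ρ-shiftˡ N zero    (suc k) = sym (cancel (Λ⊗ N (s 0) (r k)))
      where
      cancel : ∀ x → x + + 0 + + 0 - x ≡ + 0
      cancel = solve-∀
    ρ-shiftˡ N (suc j) (suc k) =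
      trans (Λ⊗-r-shift N j (r k)) (cong (λ x → ρ N (3 ℕ.+ j) (suc k) + ρ N (2 ℕ.+ j) (suc k) + ρ N (suc j) (suc k) - x) (sym (Λ⊗-1ˡ N (r k))))

    ρ-shiftʳ : ∀ N j k → ρ (suc N) j (suc k) ≡ ρ N j (2 ℕ.+ k) + ρ N j (suc k) + ρ N j k - ρ N j 2
    ρ-shiftʳ N j k = begin
      ρ (suc N) j (suc k)                                              ≡⟨ ρ-comm (suc N) j (suc k) ⟩
      ρ (suc N) (suc k) j                                              ≡⟨ ρ-shiftˡ N k j ⟩
      ρ N (2 ℕ.+ k) j + ρ N (suc k) j + ρ N k j - ρ N 2 j
        ≡⟨ cong₂ _-_ (cong₂ _+_ (cong₂ _+_ (ρ-comm N (2 ℕ.+ k) j) (ρ-comm N (suc k) j)) (ρ-comm N k j)) (ρ-comm N 2 j) ⟩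
      ρ N j (2 ℕ.+ k) + ρ N j (suc k) + ρ N j k - ρ N j 2              ∎
      where open ≡-Reasoning

    ρ-exchange : ∀ N j k →
      ρ N (3 ℕ.+ j) (suc k) + ρ N (suc j) (suc k) - ρ N 2 (suc k) ≡ ρ N (2 ℕ.+ j) (2 ℕ.+ k) + ρ N (2 ℕ.+ j) k - ρ N (2 ℕ.+ j) 2
    ρ-exchange N j k =
      cancel-middle (ρ N (3 ℕ.+ j) (suc k)) (ρ N (2 ℕ.+ j) (suc k)) (ρ N (suc j) (suc k)) (ρ N 2 (suc k))
                    (ρ N (2 ℕ.+ j) (2 ℕ.+ k)) (ρ N (2 ℕ.+ j) k) (ρ N (2 ℕ.+ j) 2) (trans (sym (ρ-shiftˡ N (suc j) (suc k))) (ρ-shiftʳ N (2 ℕ.+ j) k))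
      where
      open ≡-Reasoning
      cancel-middle : ∀ a x b c a′ b′ c′ → a + x + b - c ≡ a′ + x + b′ - c′ → a + b - c ≡ a′ + b′ - c′
      cancel-middle a x b c a′ b′ c′ e = begin
        a + b - c                  ≡⟨ solve (a ∷ x ∷ b ∷ c ∷ []) ⟩
        (a + x + b - c) - x        ≡⟨ cong (_- x) e ⟩
        (a′ + x + b′ - c′) - x     ≡⟨ solve (a′ ∷ x ∷ b′ ∷ c′ ∷ []) ⟩
        a′ + b′ - c′               ∎

    Λ-rjk : ∀ N j k → Λ N (rjk j k) ≡ ρ N (suc j) (suc k) - ρ N j k
    Λ-rjk N zero    k       = refl
    Λ-rjk N (suc j) zero    = sym (cong (_- + 0) (Λ⊗-[]ʳ N (r (suc j))))
    Λ-rjk N (suc j) (suc k) = begin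
      Λ N ((r (suc j) ⊗ r (suc k)) ⊕ (⊝ (r j ⊗ r k)))
        ≡⟨ Λ-⊕ N (r (suc j) ⊗ r (suc k)) (⊝ (r j ⊗ r k)) ⟩
      Λ⊗ N (r (suc j)) (r (suc k)) + Λ N (⊝ (r j ⊗ r k))
        ≡⟨ cong (λ x → Λ⊗ N (r (suc j)) (r (suc k)) + x) (Λ-scale N (- + 1) (r j ⊗ r k)) ⟩
      Λ⊗ N (r (suc j)) (r (suc k)) + - + 1 * Λ⊗ N (r j) (r k)
        ≡⟨ minus (Λ⊗ N (r (suc j)) (r (suc k))) (Λ⊗ N (r j) (r k)) ⟩
      Λ⊗ N (r (suc j)) (r (suc k)) - Λ⊗ N (r j) (r k) ∎
      where
      open ≡-Reasoning
      minus : ∀ x y → x + - + 1 * y ≡ x - y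
      minus = solve-∀

    Λ-rjk-shift : ∀ N j k →
      Λ (suc N) (rjk (suc j) (suc k)) ≡ Λ N (rjk (suc j) (2 ℕ.+ k)) + Λ N (rjk (2 ℕ.+ j) k) + Λ N (rjk j (suc k))
    Λ-rjk-shift N j k = begin
      Λ (suc N) (rjk (suc j) (suc k))
        ≡⟨ Λ-rjk (suc N) (suc j) (suc k) ⟩
      ρ (suc N) (2 ℕ.+ j) (2 ℕ.+ k) - ρ (suc N) (suc j) (suc k)
        ≡⟨ cong₂ _-_ (ρ-shiftʳ N (2 ℕ.+ j) (suc k)) (ρ-shiftˡ N j (suc k)) ⟩
      (ρ N (2 ℕ.+ j) (3 ℕ.+ k) + ρ N (2 ℕ.+ j) (2 ℕ.+ k) + ρ N (2 ℕ.+ j) (suc k) - ρ N (2 ℕ.+ j) 2)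
        - (ρ N (2 ℕ.+ j) (suc k) + ρ N (suc j) (suc k) + ρ N j (suc k) - ρ N 2 (suc k))
        ≡⟨ rearrange (ρ N (2 ℕ.+ j) (3 ℕ.+ k)) (ρ N (2 ℕ.+ j) (2 ℕ.+ k)) (ρ N (2 ℕ.+ j) (suc k)) (ρ N (2 ℕ.+ j) 2)
                     (ρ N (suc j) (suc k)) (ρ N j (suc k)) (ρ N 2 (suc k)) (ρ N (3 ℕ.+ j) (suc k)) (ρ N (2 ℕ.+ j) k)
                     (ρ N (suc j) (2 ℕ.+ k)) (ρ-exchange N j k) ⟩
      (ρ N (2 ℕ.+ j) (3 ℕ.+ k) - ρ N (suc j) (2 ℕ.+ k)) + (ρ N (3 ℕ.+ j) (suc k) - ρ N (2 ℕ.+ j) k)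
        + (ρ N (suc j) (2 ℕ.+ k) - ρ N j (suc k))
        ≡⟨ sym (cong₂ _+_ (cong₂ _+_ (Λ-rjk N (suc j) (2 ℕ.+ k)) (Λ-rjk N (2 ℕ.+ j) k)) (Λ-rjk N j (suc k))) ⟩
      Λ N (rjk (suc j) (2 ℕ.+ k)) + Λ N (rjk (2 ℕ.+ j) k) + Λ N (rjk j (suc k)) ∎
      where
      open ≡-Reasoning
      rearrange : ∀ a b c d e f g h i x → h + e - g ≡ b + i - d →
        (a + b + c - d) - (c + e + f - g) ≡ (a - x) + (h - i) + (x - f)
      rearrange a b c d e f g h i x exchange = begin
        (a + b + c - d) - (c + e + f - g)
          ≡⟨ solve (a ∷ b ∷ c ∷ d ∷ e ∷ f ∷ g ∷ h ∷ i ∷ x ∷ []) ⟩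
        (a - x) + (h - i) + (x - f) + ((b + i - d) - (h + e - g))
          ≡⟨ cong (λ y → (a - x) + (h - i) + (x - f) + (y - (h + e - g))) (sym exchange) ⟩
        (a - x) + (h - i) + (x - f) + ((h + e - g) - (h + e - g))
          ≡⟨ solve (a ∷ e ∷ f ∷ g ∷ h ∷ i ∷ x ∷ []) ⟩
        (a - x) + (h - i) + (x - f) ∎

  motzkinMoment : ℕ → ℤ
  motzkinMoment N = + motzkinPaths N 0

  open Moments motzkinMoment

  Λ-s : ∀ N b → Λ N (s b) ≡ + motzkinPaths N b
  Λ-s N zero = unit (+ motzkinPaths N 0)
    where
    unit : ∀ x → + 1 * x + + 0 ≡ x
    unit = solve-∀
  Λ-s N (suc zero) = begin
    - + 1 * + 1 * + motzkinPaths N 0 + (- + 1 * - + 1 * + (motzkinPaths N 0 ℕ.+ motzkinPaths N 1) + + 0)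
      ≡⟨ cong (λ x → - + 1 * + 1 * + motzkinPaths N 0 + (- + 1 * - + 1 * x + + 0)) (pos-+ (motzkinPaths N 0) _) ⟩
    - + 1 * + 1 * + motzkinPaths N 0 + (- + 1 * - + 1 * (+ motzkinPaths N 0 + + motzkinPaths N 1) + + 0)
      ≡⟨ simplify (+ motzkinPaths N 0) (+ motzkinPaths N 1) ⟩
    + motzkinPaths N 1 ∎
    where
    open ≡-Reasoning
    simplify : ∀ x y → - + 1 * + 1 * x + (- + 1 * - + 1 * (x + y) + + 0) ≡ y
    simplify = solve-∀
  Λ-s N (suc (suc b)) = begin
    Λ N ((⊝ (oneMinusX ⊗ s (suc b))) ⊕ (⊝ s b))
      ≡⟨ Λ-⊕ N (⊝ (oneMinusX ⊗ s (suc b))) (⊝ s b) ⟩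
    Λ N (⊝ (oneMinusX ⊗ s (suc b))) + Λ N (⊝ s b)
      ≡⟨ cong₂ _+_ (Λ-scale N (- + 1) (oneMinusX ⊗ s (suc b))) (Λ-scale N (- + 1) (s b)) ⟩
    - + 1 * Λ⊗ N oneMinusX (s (suc b)) + - + 1 * Λ N (s b)
      ≡⟨ cong (λ x → - + 1 * x + - + 1 * Λ N (s b))
              (trans (Λ⊗-∷ˡ N (+ 1) (- + 1 ∷ []) (s (suc b)))
                     (cong (λ x → + 1 * Λ N (s (suc b)) + x) (Λ⊗-∷ˡ (suc N) (- + 1) [] (s (suc b))))) ⟩
    - + 1 * (+ 1 * Λ N (s (suc b)) + (- + 1 * Λ (suc N) (s (suc b)) + + 0)) + - + 1 * Λ N (s b)
      ≡⟨ cong₂ (λ x y → - + 1 * (+ 1 * x + (- + 1 * y + + 0)) + - + 1 * Λ N (s b))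
               (Λ-s N (suc b)) (trans (Λ-s (suc N) (suc b)) paths-step) ⟩
    - + 1 * (+ 1 * + motzkinPaths N (suc b) + (- + 1 * (+ motzkinPaths N b + + motzkinPaths N (suc b) + + motzkinPaths N (2 ℕ.+ b)) + + 0))
      + - + 1 * Λ N (s b)
      ≡⟨ cong (λ x → - + 1 * (+ 1 * + motzkinPaths N (suc b) + (- + 1 * (+ motzkinPaths N b + + motzkinPaths N (suc b) + + motzkinPaths N (2 ℕ.+ b)) + + 0)) + - + 1 * x) (Λ-s N b) ⟩
    - + 1 * (+ 1 * + motzkinPaths N (suc b) + (- + 1 * (+ motzkinPaths N b + + motzkinPaths N (suc b) + + motzkinPaths N (2 ℕ.+ b)) + + 0))
      + - + 1 * + motzkinPaths N b
      ≡⟨ simplify (+ motzkinPaths N b) (+ motzkinPaths N (suc b)) (+ motzkinPaths N (2 ℕ.+ b)) ⟩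
    + motzkinPaths N (2 ℕ.+ b) ∎
    where
    open ≡-Reasoning
    paths-step : + motzkinPaths (suc N) (suc b) ≡ + motzkinPaths N b + + motzkinPaths N (suc b) + + motzkinPaths N (2 ℕ.+ b)
    paths-step = trans (pos-+ (motzkinPaths N b ℕ.+ motzkinPaths N (suc b)) _) (cong (_+ + motzkinPaths N (2 ℕ.+ b)) (pos-+ (motzkinPaths N b) _))
    simplify : ∀ x y z → - + 1 * (+ 1 * y + (- + 1 * (x + y + z) + + 0)) + - + 1 * x ≡ z
    simplify = solve-∀

  Λ-r-zero : ∀ k → Λ 0 (r (suc k)) ≡ + 1
  Λ-r-zero zero    = Λ-s 0 0
  Λ-r-zero (suc k) = trans (Λ-⊕ 0 (r (suc k)) (s (suc k))) (cong₂ _+_ (Λ-r-zero k) (Λ-s 0 (suc k)))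

  ρ-zero-two : ∀ k → ρ 0 2 (suc k) ≡ + (1 ⊓ k)
  ρ-zero-two zero    = refl
  ρ-zero-two (suc k) = trans (Λ⊗-1ˡ 0 (r (suc k))) (Λ-r-zero k)

  min-exchange : ∀ j k → (2 ℕ.+ j) ⊓ k ℕ.+ j ⊓ k ℕ.+ (suc j) ⊓ 1 ≡ (suc j) ⊓ (suc k) ℕ.+ (suc j) ⊓ pred k ℕ.+ 1 ⊓ k
  min-exchange j zero    rewrite ℕ.⊓-zeroʳ j = refl
  min-exchange j (suc k) rewrite ℕ.⊓-zeroʳ j = cong (λ x → suc x ℕ.+ 1) (ℕ.+-comm (suc j ⊓ k) (j ⊓ suc k))

  solve-exchange : ∀ X x e g b i d → X + e - g ≡ b + i - d → x + e + d ≡ b + i + g → X ≡ x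
  solve-exchange X x e g b i d exchange balance = begin
    X                           ≡⟨ solve (X ∷ e ∷ g ∷ []) ⟩
    (X + e - g) + g - e         ≡⟨ cong (λ y → y + g - e) exchange ⟩
    (b + i - d) + g - e         ≡⟨ solve (b ∷ i ∷ d ∷ g ∷ e ∷ []) ⟩
    (b + i + g) - e - d         ≡⟨ cong (λ y → y - e - d) (sym balance) ⟩
    (x + e + d) - e - d         ≡⟨ solve (x ∷ e ∷ d ∷ []) ⟩
    x                           ∎
    where open ≡-Reasoning

  pos-+³ : ∀ x y z → + (x ℕ.+ y ℕ.+ z) ≡ + x + + y + + z
  pos-+³ x y z = trans (pos-+ (x ℕ.+ y) z) (cong (_+ + z) (pos-+ x y))

  ρ-zero : ∀ j k → ρ 0 j k ≡ + (pred j ⊓ pred k)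
  ρ-zero zero                k       = refl
  ρ-zero (suc j)             zero    = cong +_ (sym (ℕ.⊓-zeroʳ j))
  ρ-zero (suc zero)          (suc k) = refl
  ρ-zero (suc (suc zero))    (suc k) = ρ-zero-two k
  ρ-zero (suc (suc (suc j))) (suc k) =
    solve-exchange (ρ 0 (3 ℕ.+ j) (suc k)) (+ ((2 ℕ.+ j) ⊓ k))
      (+ (j ⊓ k)) (+ (1 ⊓ k)) (+ ((suc j) ⊓ (suc k))) (+ ((suc j) ⊓ pred k)) (+ ((suc j) ⊓ 1))
      (trans (sym (cong₂ (λ x y → ρ 0 (3 ℕ.+ j) (suc k) + x - y) (ρ-zero (suc j) (suc k)) (ρ-zero-two k)))
        (trans (ρ-exchange 0 j k)
          (cong₂ _-_ (cong₂ _+_ (ρ-zero (suc (suc j)) (suc (suc k))) (ρ-zero (suc (suc j)) k)) (ρ-zero (suc (suc j)) 2))))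
      (trans (sym (pos-+³ ((2 ℕ.+ j) ⊓ k) (j ⊓ k) ((suc j) ⊓ 1)))
        (trans (cong +_ (min-exchange j k)) (pos-+³ ((suc j) ⊓ (suc k)) ((suc j) ⊓ pred k) (1 ⊓ k))))

  Λ-rjk-zero : ∀ j k → Λ 0 (rjk (suc j) (suc k)) ≡ + 1
  Λ-rjk-zero j k = begin
    Λ 0 (rjk (suc j) (suc k))                         ≡⟨ Λ-rjk 0 (suc j) (suc k) ⟩
    ρ 0 (2 ℕ.+ j) (2 ℕ.+ k) - ρ 0 (suc j) (suc k)     ≡⟨ cong₂ _-_ (ρ-zero (2 ℕ.+ j) (2 ℕ.+ k)) (ρ-zero (suc j) (suc k)) ⟩
    + (suc (j ⊓ k)) - + (j ⊓ k)                       ≡⟨ cong (_- + (j ⊓ k)) (pos-+ 1 (j ⊓ k)) ⟩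
    + 1 + + (j ⊓ k) - + (j ⊓ k)                       ≡⟨ cancel (+ (j ⊓ k)) ⟩
    + 1 ∎
    where
    open ≡-Reasoning
    cancel : ∀ x → + 1 + x - x ≡ + 1
    cancel = solve-∀

  motzkinCombination≡Λ : ∀ j k N → motzkinCombination j k N ≡ Λ N (rjk j k)
  motzkinCombination≡Λ j k N =
    trans (sumℤ-cong (length (rjk j k)) (λ i → cong (λ m → coeff (rjk j k) i * + m) (Motzkin≡motzkinPaths (i ℕ.+ N))))
          (Λ-as-sum N (rjk j k))

module SkewTableaux where

  open import Data.Nat
  open import Data.Nat.Properties
  open import Data.List using (List; []; _∷_; length; _++_; applyUpTo; concatMap; map)
  open import Data.Nat.ListAction using (sum)
  open import Data.Nat.ListAction.Properties using (sum-++)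
  open import Data.List.Properties using (map-++; length-++; ++-assoc; applyUpTo-∷ʳ; ++-identityʳ; ∷ʳ-injectiveˡ)
  open import Data.List.Membership.Propositional using (_∈_)
  open import Data.List.Membership.Propositional.Properties using (∈-++⁻; ∈-++⁺ˡ; ∈-++⁺ʳ; ∈-∃++)
  open import Data.List.Relation.Unary.Any using (here; there)
  open import Data.List.Relation.Unary.All using ([]; _∷_; tabulate; lookup)
  open import Data.List.Relation.Unary.AllPairs using ([]; _∷_)
  open import Data.List.Relation.Unary.Unique.Propositional using (Unique)
  import Data.List.Relation.Unary.Unique.Propositional.Properties as Unique
  open import Data.List.Relation.Binary.Permutation.Propositional using (_↭_; prep; ↭-trans; ↭-sym; ↭-reflexive)
  open import Data.List.Relation.Binary.Permutation.Propositional.Properties using (shift; drop-mid; ∈-resp-↭)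
  open import Relation.Nullary using (Dec; yes; no; ¬_)
  open import Data.Nat.Tactic.RingSolver
  open import Data.Maybe using (just)
  open import Data.Maybe.Properties using (just-injective)
  open import Data.Product using (∃; _×_; _,_; proj₁)
  open import Data.Sum using (_⊎_; inj₁; inj₂)
  open import Data.Empty using (⊥; ⊥-elim)
  open import Function using (_∘_)
  open import Relation.Binary.PropositionalEquality
  open import Defs

  nth-++ˡ : ∀ (t u : List ℕ) i {a} → nth t i ≡ just a → nth (t ++ u) i ≡ just a
  nth-++ˡ (x ∷ t) u zero    h = h
  nth-++ˡ (x ∷ t) u (suc i) h = nth-++ˡ t u i h

  nth-∷ʳ : ∀ t e i {a} → nth (t ++ e ∷ []) i ≡ just a → nth t i ≡ just a ⊎ (a ≡ e × i ≡ length t)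
  nth-∷ʳ []      e zero    h = inj₂ (sym (just-injective h) , refl)
  nth-∷ʳ (x ∷ t) e zero    h = inj₁ h
  nth-∷ʳ (x ∷ t) e (suc i) h with nth-∷ʳ t e i h
  ... | inj₁ p       = inj₁ p
  ... | inj₂ (p , q) = inj₂ (p , cong suc q)

  nth-∈ : ∀ t i {a} → nth t i ≡ just a → a ∈ t
  nth-∈ (x ∷ t) zero    h = here (sym (just-injective h))
  nth-∈ (x ∷ t) (suc i) h = there (nth-∈ t i h)

  nth-<length : ∀ t i {a} → nth t i ≡ just a → i < length t
  nth-<length (x ∷ t) zero    h = s≤s z≤n
  nth-<length (x ∷ t) (suc i) h = s≤s (nth-<length t i h)

  nth-defined : ∀ t i → i < length t → ∃ λ a → nth t i ≡ just a
  nth-defined (x ∷ t) zero    _         = x , refl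
  nth-defined (x ∷ t) (suc i) (s≤s i<n) = nth-defined t i i<n

  nth-++-length : ∀ ys zs i → nth (ys ++ zs) (length ys + i) ≡ nth zs i
  nth-++-length []       zs i = refl
  nth-++-length (y ∷ ys) zs i = nth-++-length ys zs i

  entry-offset : ∀ off t i → entry off t (off + i) ≡ nth t i
  entry-offset zero      t i = refl
  entry-offset (suc off) t i = entry-offset off t i

  entry-inverse : ∀ off t c {a} → entry off t c ≡ just a → ∃ λ i → c ≡ off + i × nth t i ≡ just a
  entry-inverse zero      t c       h = c , refl , h
  entry-inverse (suc off) t (suc c) h with entry-inverse off t c h
  ... | i , c≡ , n = i , cong suc c≡ , n

  entry-++ˡ : ∀ off (t u : List ℕ) c {a} → entry off t c ≡ just a → entry off (t ++ u) c ≡ just a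
  entry-++ˡ zero      t u c       h = nth-++ˡ t u c h
  entry-++ˡ (suc off) t u (suc c) h = entry-++ˡ off t u c h

  entry-∷ʳ : ∀ off t e c {a} → entry off (t ++ e ∷ []) c ≡ just a → entry off t c ≡ just a ⊎ (a ≡ e × c ≡ off + length t)
  entry-∷ʳ zero      t e c       h = nth-∷ʳ t e c h
  entry-∷ʳ (suc off) t e (suc c) h with entry-∷ʳ off t e c h
  ... | inj₁ p       = inj₁ p
  ... | inj₂ (p , q) = inj₂ (p , cong suc q)

  entry-<end : ∀ off t c {a} → entry off t c ≡ just a → c < off + length t
  entry-<end zero      t c       h = nth-<length t c h
  entry-<end (suc off) t (suc c) h = s≤s (entry-<end off t c h)

  entry-∈ : ∀ off t c {a} → entry off t c ≡ just a → a ∈ t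
  entry-∈ zero      t c       h = nth-∈ t c h
  entry-∈ (suc off) t (suc c) h = entry-∈ off t c h

  entry-last : ∀ off (t : List ℕ) e → entry off (t ++ e ∷ []) (off + length t) ≡ just e
  entry-last off t e = trans (entry-offset off (t ++ e ∷ []) (length t)) (last t)
    where
    last : ∀ (t : List ℕ) → nth (t ++ e ∷ []) (length t) ≡ just e
    last []      = refl
    last (x ∷ t) = last t

  entry-defined : ∀ off t i → i < length t → ∃ λ a → entry off t (off + i) ≡ just a × a ∈ t
  entry-defined off t i i<n with nth-defined t i i<n
  ... | a , h = a , trans (entry-offset off t i) h , nth-∈ t i h

  Increasing : List ℕ → Set
  Increasing t = ∀ i a b → nth t i ≡ just a → nth t (suc i) ≡ just b → a < b

  RowIncreasing⇒Increasing : ∀ off t → RowIncreasing off t → Increasing t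
  RowIncreasing⇒Increasing off t inc i a b h₁ h₂ =
    inc (off + i) a b (trans (entry-offset off t i) h₁)
        (trans (cong (entry off t) (sym (+-suc off i))) (trans (entry-offset off t (suc i)) h₂))

  Increasing⇒RowIncreasing : ∀ off t → Increasing t → RowIncreasing off t
  Increasing⇒RowIncreasing off t inc c a b h₁ h₂ with entry-inverse off t c h₁
  ... | i , refl , n = inc i a b n (trans (sym (entry-offset off t (suc i))) (trans (cong (entry off t) (+-suc off i)) h₂))

  RowIncreasing-++ˡ : ∀ off t u → RowIncreasing off (t ++ u) → RowIncreasing off t
  RowIncreasing-++ˡ off t u inc =
    Increasing⇒RowIncreasing off t (λ i a b h₁ h₂ →
      RowIncreasing⇒Increasing off (t ++ u) inc i a b (nth-++ˡ t u i h₁) (nth-++ˡ t u (suc i) h₂))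

  RowIncreasing-∷ʳ : ∀ off t e → RowIncreasing off t → (∀ a → a ∈ t → a < e) → RowIncreasing off (t ++ e ∷ [])
  RowIncreasing-∷ʳ off t e inc below = Increasing⇒RowIncreasing off (t ++ e ∷ []) increasing
    where
    increasing : Increasing (t ++ e ∷ [])
    increasing i a b h₁ h₂ with nth-∷ʳ t e i h₁ | nth-∷ʳ t e (suc i) h₂
    ... | inj₁ p            | inj₁ q            = RowIncreasing⇒Increasing off t inc i a b p q
    ... | inj₁ p            | inj₂ (refl , _)   = below a (nth-∈ t i p)
    ... | inj₂ (_ , refl)   | inj₁ q            = ⊥-elim (<-irrefl refl (≤-trans (n≤1+n _) (nth-<length t _ q)))
    ... | inj₂ (_ , refl)   | inj₂ (_ , i+1≡i)  = ⊥-elim (1+n≢n i+1≡i)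

  ColIncreasing-++ᵘ : ∀ o₁ t₁ u o₂ t₂ → ColIncreasing o₁ (t₁ ++ u) o₂ t₂ → ColIncreasing o₁ t₁ o₂ t₂
  ColIncreasing-++ᵘ o₁ t₁ u o₂ t₂ inc c a b h₁ h₂ = inc c a b (entry-++ˡ o₁ t₁ u c h₁) h₂

  ColIncreasing-++ₗ : ∀ o₁ t₁ o₂ t₂ u → ColIncreasing o₁ t₁ o₂ (t₂ ++ u) → ColIncreasing o₁ t₁ o₂ t₂
  ColIncreasing-++ₗ o₁ t₁ o₂ t₂ u inc c a b h₁ h₂ = inc c a b h₁ (entry-++ˡ o₂ t₂ u c h₂)

  ColIncreasing-∷ʳᵘ : ∀ o₁ t₁ e o₂ t₂ → ColIncreasing o₁ t₁ o₂ t₂ → o₂ + length t₂ ≤ o₁ + length t₁ →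
                      ColIncreasing o₁ (t₁ ++ e ∷ []) o₂ t₂
  ColIncreasing-∷ʳᵘ o₁ t₁ e o₂ t₂ inc end≤ c a b h₁ h₂ with entry-∷ʳ o₁ t₁ e c h₁
  ... | inj₁ p        = inc c a b p h₂
  ... | inj₂ (_ , refl) = ⊥-elim (<-irrefl refl (≤-trans (entry-<end o₂ t₂ _ h₂) end≤))

  ColIncreasing-∷ʳₗ : ∀ o₁ t₁ o₂ t₂ e → ColIncreasing o₁ t₁ o₂ t₂ → (∀ a → a ∈ t₁ → a < e) →
                      ColIncreasing o₁ t₁ o₂ (t₂ ++ e ∷ [])
  ColIncreasing-∷ʳₗ o₁ t₁ o₂ t₂ e inc below c a b h₁ h₂ with entry-∷ʳ o₂ t₂ e c h₂
  ... | inj₁ p          = inc c a b h₁ p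
  ... | inj₂ (refl , _) = below a (entry-∈ o₁ t₁ c h₁)

  ∈-applyUpTo⇒≤ : ∀ N v → v ∈ applyUpTo suc N → v ≤ N
  ∈-applyUpTo⇒≤ (suc N) v v∈ with ∈-++⁻ (applyUpTo suc N) (subst (v ∈_) (sym (applyUpTo-∷ʳ suc N)) v∈)
  ... | inj₁ p         = ≤-trans (∈-applyUpTo⇒≤ N v p) (n≤1+n N)
  ... | inj₂ (here refl) = ≤-refl

  last-∈-applyUpTo : ∀ N → suc N ∈ applyUpTo suc (suc N)
  last-∈-applyUpTo N = subst (suc N ∈_) (applyUpTo-∷ʳ suc N) (∈-++⁺ʳ (applyUpTo suc N) (here refl))

  maximum-is-last : ∀ t e → Increasing t → (∀ a → a ∈ t → a ≤ e) → e ∈ t → ∃ λ t′ → t ≡ t′ ++ e ∷ []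
  maximum-is-last t e inc ≤e e∈ with ∈-∃++ e∈
  ... | ys , []     , refl = ys , refl
  ... | ys , z ∷ zs , refl = ⊥-elim (<⇒≱ e<z (≤e z (∈-++⁺ʳ ys (there (here refl)))))
    where
    e<z : e < z
    e<z = inc (length ys + 0) e z (nth-++-length ys (e ∷ z ∷ zs) 0)
            (trans (cong (nth (ys ++ e ∷ z ∷ zs)) (sym (+-suc (length ys) 0))) (nth-++-length ys (e ∷ z ∷ zs) 1))

  length-∷ʳ : ∀ (t : List ℕ) e → length (t ++ e ∷ []) ≡ suc (length t)
  length-∷ʳ t e = trans (length-++ t) (+-comm (length t) 1)

  ↭-insert : ∀ (ws rest P : List ℕ) e → ws ++ rest ↭ P → ws ++ e ∷ rest ↭ P ++ e ∷ []
  ↭-insert ws rest P e p =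
    ↭-trans (shift e ws rest) (↭-trans (prep e p) (↭-sym (↭-trans (shift e P []) (prep e (↭-reflexive (++-identityʳ P))))))

  ↭-remove : ∀ (ws rest P : List ℕ) e → ws ++ e ∷ rest ↭ P ++ e ∷ [] → ws ++ rest ↭ P
  ↭-remove ws rest P e p = ↭-trans (drop-mid ws P p) (↭-reflexive (++-identityʳ P))

  skewSize : ∀ {μ₁ μ₂ a b c N} → μ₁ ≤ a → μ₂ ≤ b → a + b + c ≡ μ₁ + μ₂ + N → (a ∸ μ₁) + (b ∸ μ₂) + c ≡ N
  skewSize {μ₁} {μ₂} {a} {b} {c} μ₁≤a μ₂≤b total =
    +-cancelˡ-≡ (μ₁ + μ₂) _ _
      (trans (regroup μ₁ (a ∸ μ₁) μ₂ (b ∸ μ₂) c)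
             (trans (cong₂ (λ u v → u + v + c) (m+[n∸m]≡n μ₁≤a) (m+[n∸m]≡n μ₂≤b)) total))
    where
    regroup : ∀ m x n y z → m + n + (x + y + z) ≡ m + x + (n + y) + z
    regroup = solve-∀

  optional : {P : Set} {A : Set} → Dec P → A → List A
  optional (yes _) x = x ∷ []
  optional (no _)  x = []

  ∈-optional⁺ : ∀ {P A : Set} (d : Dec P) (x : A) → P → x ∈ optional d x
  ∈-optional⁺ (yes _) x p = here refl
  ∈-optional⁺ (no ¬p) x p = ⊥-elim (¬p p)

  ∈-optional⁻ : ∀ {P A : Set} (d : Dec P) (x z : A) → z ∈ optional d x → z ≡ x × P
  ∈-optional⁻ (yes p) x z (here refl) = refl , p

  ∈-concatMap⁺ : ∀ {A B : Set} (f : A → List B) xs {y z} → y ∈ xs → z ∈ f y → z ∈ concatMap f xs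
  ∈-concatMap⁺ f (x ∷ xs) (here refl) z∈ = ∈-++⁺ˡ z∈
  ∈-concatMap⁺ f (x ∷ xs) (there y∈)  z∈ = ∈-++⁺ʳ (f x) (∈-concatMap⁺ f xs y∈ z∈)

  ∈-concatMap⁻ : ∀ {A B : Set} (f : A → List B) xs {z} → z ∈ concatMap f xs → ∃ λ y → y ∈ xs × z ∈ f y
  ∈-concatMap⁻ f (x ∷ xs) z∈ with ∈-++⁻ (f x) z∈
  ... | inj₁ p = x , here refl , p
  ... | inj₂ p with ∈-concatMap⁻ f xs p
  ...   | y , y∈ , q = y , there y∈ , q

  Unique-concatMap : ∀ {A B : Set} (f : A → List B) xs → Unique xs → (∀ x → x ∈ xs → Unique (f x)) →
    (∀ {x y z} → x ∈ xs → y ∈ xs → z ∈ f x → z ∈ f y → x ≡ y) → Unique (concatMap f xs)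
  Unique-concatMap f []       _            _        _        = []
  Unique-concatMap f (x ∷ xs) (x∉xs ∷ uxs) unique-f disjoint =
    Unique.++⁺ (unique-f x (here refl))
      (Unique-concatMap f xs uxs (λ y y∈ → unique-f y (there y∈)) (λ x∈ y∈ → disjoint (there x∈) (there y∈)))
      separated
    where
    separated : ∀ {v} → ¬ (v ∈ f x × v ∈ concatMap f xs)
    separated (v∈fx , v∈rest) with ∈-concatMap⁻ f xs v∈rest
    ... | y , y∈ , v∈fy = lookup x∉xs y∈ (disjoint (here refl) (there y∈) v∈fx v∈fy)

  Candidate : Set
  Candidate = Shape × Filling

  grow₁ grow₂ grow₃ : ℕ → Candidate → Candidate
  grow₁ e ((a , b , c) , (t₁ , t₂ , t₃)) = (suc a , b , c) , (t₁ ++ e ∷ [] , t₂ , t₃)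
  grow₂ e ((a , b , c) , (t₁ , t₂ , t₃)) = (a , suc b , c) , (t₁ , t₂ ++ e ∷ [] , t₃)
  grow₃ e ((a , b , c) , (t₁ , t₂ , t₃)) = (a , b , suc c) , (t₁ , t₂ , t₃ ++ e ∷ [])

  extensions : ℕ → Candidate → List Candidate
  extensions e x@((a , b , c) , _) = grow₁ e x ∷ (optional (b <? a) (grow₂ e x) ++ optional (c <? b) (grow₃ e x))

  ∈-extensions⁻ : ∀ e a b c t₁ t₂ t₃ {z} → z ∈ extensions e ((a , b , c) , (t₁ , t₂ , t₃)) →
    z ≡ grow₁ e ((a , b , c) , (t₁ , t₂ , t₃))
    ⊎ (z ≡ grow₂ e ((a , b , c) , (t₁ , t₂ , t₃)) × b < a)
    ⊎ (z ≡ grow₃ e ((a , b , c) , (t₁ , t₂ , t₃)) × c < b)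
  ∈-extensions⁻ e a b c t₁ t₂ t₃ (here refl) = inj₁ refl
  ∈-extensions⁻ e a b c t₁ t₂ t₃ {z} (there z∈) with ∈-++⁻ (optional (b <? a) (grow₂ e ((a , b , c) , (t₁ , t₂ , t₃)))) z∈
  ... | inj₁ p = inj₂ (inj₁ (∈-optional⁻ (b <? a) _ z p))
  ... | inj₂ p = inj₂ (inj₂ (∈-optional⁻ (c <? b) _ z p))

  part₁ part₂ part₃ : Candidate → ℕ
  part₁ ((a , _ , _) , _) = a
  part₂ ((_ , b , _) , _) = b
  part₃ ((_ , _ , c) , _) = c

  row₁ row₂ row₃ : Candidate → List ℕ
  row₁ (_ , (t , _ , _)) = t
  row₂ (_ , (_ , t , _)) = t
  row₃ (_ , (_ , _ , t)) = t

  entries : Candidate → List ℕ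
  entries (_ , (t₁ , t₂ , t₃)) = t₁ ++ t₂ ++ t₃

  grow₁-injective : ∀ e x y → grow₁ e x ≡ grow₁ e y → x ≡ y
  grow₁-injective e (_ , (t₁ , _)) (_ , (t₁′ , _)) eq with ∷ʳ-injectiveˡ t₁ t₁′ (cong row₁ eq) | cong part₁ eq
  ... | refl | refl with eq
  ...   | refl = refl

  grow₂-injective : ∀ e x y → grow₂ e x ≡ grow₂ e y → x ≡ y
  grow₂-injective e (_ , (_ , t₂ , _)) (_ , (_ , t₂′ , _)) eq with ∷ʳ-injectiveˡ t₂ t₂′ (cong row₂ eq) | cong part₂ eq
  ... | refl | refl with eq
  ...   | refl = refl

  grow₃-injective : ∀ e x y → grow₃ e x ≡ grow₃ e y → x ≡ y
  grow₃-injective e (_ , (_ , _ , t₃)) (_ , (_ , _ , t₃′)) eq with ∷ʳ-injectiveˡ t₃ t₃′ (cong row₃ eq) | cong part₃ eq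
  ... | refl | refl with eq
  ...   | refl = refl

  sum-map-++ : ∀ {A : Set} (g : A → ℕ) xs ys → sum (map g (xs ++ ys)) ≡ sum (map g xs) + sum (map g ys)
  sum-map-++ g xs ys = trans (cong sum (map-++ g xs ys)) (sum-++ (map g xs) (map g ys))

  sum-map-concatMap : ∀ {A B : Set} (g : B → ℕ) (f : A → List B) xs →
    sum (map g (concatMap f xs)) ≡ sum (map (λ x → sum (map g (f x))) xs)
  sum-map-concatMap g f []       = refl
  sum-map-concatMap g f (x ∷ xs) =
    trans (sum-map-++ g (f x) (concatMap f xs)) (cong (sum (map g (f x)) +_) (sum-map-concatMap g f xs))

  sum-map-cong : ∀ {A : Set} {g h : A → ℕ} xs → (∀ x → g x ≡ h x) → sum (map g xs) ≡ sum (map h xs)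
  sum-map-cong []       g≡h = refl
  sum-map-cong (x ∷ xs) g≡h = cong₂ _+_ (g≡h x) (sum-map-cong xs g≡h)

  length≡sum-map-1 : ∀ {A : Set} (xs : List A) → length xs ≡ sum (map (λ _ → 1) xs)
  length≡sum-map-1 []       = refl
  length≡sum-map-1 (x ∷ xs) = cong suc (length≡sum-map-1 xs)

  ifᵈ : {P : Set} → Dec P → ℕ → ℕ
  ifᵈ (yes _) n = n
  ifᵈ (no _)  n = 0

  sum-map-optional : ∀ {P A : Set} (g : A → ℕ) (d : Dec P) x → sum (map g (optional d x)) ≡ ifᵈ d (g x)
  sum-map-optional g (yes _) x = +-identityʳ (g x)
  sum-map-optional g (no _)  x = refl

  completions : ℕ → Shape → ℕ
  completions zero    _           = 1
  completions (suc K) (a , b , c) =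
    completions K (suc a , b , c) + (ifᵈ (b <? a) (completions K (a , suc b , c)) + ifᵈ (c <? b) (completions K (a , b , suc c)))

  sum-completions-extensions : ∀ e K x → sum (map (completions K ∘ proj₁) (extensions e x)) ≡ completions (suc K) (proj₁ x)
  sum-completions-extensions e K x@((a , b , c) , _) =
    cong (completions K (suc a , b , c) +_)
      (trans (sum-map-++ (completions K ∘ proj₁) (optional (b <? a) (grow₂ e x)) (optional (c <? b) (grow₃ e x)))
             (cong₂ _+_ (sum-map-optional (completions K ∘ proj₁) (b <? a) (grow₂ e x))
                        (sum-map-optional (completions K ∘ proj₁) (c <? b) (grow₃ e x))))

  grow₁≢grow₂ : ∀ e x → grow₁ e x ≢ grow₂ e x
  grow₁≢grow₂ e x eq = 1+n≢n (cong part₁ eq)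

  grow₁≢grow₃ : ∀ e x → grow₁ e x ≢ grow₃ e x
  grow₁≢grow₃ e x eq = 1+n≢n (cong part₁ eq)

  grow₂≢grow₃ : ∀ e x → grow₂ e x ≢ grow₃ e x
  grow₂≢grow₃ e x eq = 1+n≢n (cong part₂ eq)

  ∈-∷ʳ-≡ : ∀ {e} (t : List ℕ) {t′} → t ++ e ∷ [] ≡ t′ → e ∈ t′
  ∈-∷ʳ-≡ t eq = subst (_ ∈_) eq (∈-++⁺ʳ t (here refl))

  module Tableaux (μ₁ μ₂ : ℕ) (μ₂≤μ₁ : μ₂ ≤ μ₁) where

    IsTableau : ℕ → Candidate → Set
    IsTableau N = SkewSYT3 μ₁ μ₂ (μ₁ + μ₂ + N)

    tableaux : ℕ → List Candidate
    tableaux zero    = ((μ₁ , μ₂ , 0) , ([] , [] , [])) ∷ []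
    tableaux (suc N) = concatMap (extensions (suc N)) (tableaux N)

    entries-↭ : ∀ N {x} → IsTableau N x → entries x ↭ applyUpTo suc N
    entries-↭ N {x = _ , (t₁ , t₂ , t₃)} ((_ , _ , total , μ₁≤a , μ₂≤b) , (_ , _ , _ , perm , _)) =
      subst (λ n → t₁ ++ t₂ ++ t₃ ↭ applyUpTo suc n) (skewSize μ₁≤a μ₂≤b total) perm

    entries-≤ : ∀ N {x} → IsTableau N x → ∀ v → v ∈ entries x → v ≤ N
    entries-≤ N t v v∈ = ∈-applyUpTo⇒≤ N v (∈-resp-↭ (entries-↭ N t) v∈)

    entries-↭-size : ∀ N {a b c} (ts : List ℕ) → μ₁ ≤ a → μ₂ ≤ b → a + b + c ≡ μ₁ + μ₂ + N →
      ts ↭ applyUpTo suc N → ts ↭ applyUpTo suc ((a ∸ μ₁) + (b ∸ μ₂) + c)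
    entries-↭-size N ts μ₁≤a μ₂≤b total = subst (λ n → ts ↭ applyUpTo suc n) (sym (skewSize μ₁≤a μ₂≤b total))

    total-suc : ∀ N → suc (μ₁ + μ₂ + N) ≡ μ₁ + μ₂ + suc N
    total-suc N = sym (+-suc (μ₁ + μ₂) N)

    row-end : ∀ {μ a} (t : List ℕ) → length t ≡ a ∸ μ → μ ≤ a → μ + length t ≡ a
    row-end {μ} t len μ≤a = trans (cong (μ +_) len) (m+[n∸m]≡n μ≤a)

    start-isTableau : IsTableau 0 ((μ₁ , μ₂ , 0) , ([] , [] , []))
    start-isTableau =
      (μ₂≤μ₁ , z≤n , refl , ≤-refl , ≤-refl) ,
      (sym (n∸n≡0 μ₁) , sym (n∸n≡0 μ₂) , refl ,
       subst (λ n → [] ↭ applyUpTo suc n) (sym (cong₂ (λ u v → u + v + 0) (n∸n≡0 μ₁) (n∸n≡0 μ₂))) (↭-reflexive refl) ,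
       (λ c a b h _ → empty (entry-∈ μ₁ [] c h)) , (λ c a b h _ → empty (entry-∈ μ₂ [] c h)) ,
       (λ c a b h _ → empty (entry-∈ 0 [] c h)) ,
       (λ c a b h _ → empty (entry-∈ μ₁ [] c h)) , (λ c a b h _ → empty (entry-∈ μ₂ [] c h)))
      where
      empty : ∀ {A : Set} {v : ℕ} → v ∈ [] → A
      empty ()

    grow₁-isTableau : ∀ N x → IsTableau N x → IsTableau (suc N) (grow₁ (suc N) x)
    grow₁-isTableau N x@((a , b , c) , (t₁ , t₂ , t₃))
      t@((b≤a , c≤b , total , μ₁≤a , μ₂≤b) , (len₁ , len₂ , len₃ , _ , inc₁ , inc₂ , inc₃ , col₁₂ , col₂₃)) =
      (≤-trans b≤a (n≤1+n a) , c≤b , total′ , ≤-trans μ₁≤a (n≤1+n a) , μ₂≤b) ,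
      (trans (length-∷ʳ t₁ e) (trans (cong suc len₁) (sym (+-∸-assoc 1 μ₁≤a))) , len₂ , len₃ ,
       entries-↭-size (suc N) ((t₁ ++ e ∷ []) ++ t₂ ++ t₃) (≤-trans μ₁≤a (n≤1+n a)) μ₂≤b total′
         (subst₂ _↭_ (sym (++-assoc t₁ (e ∷ []) (t₂ ++ t₃))) (applyUpTo-∷ʳ suc N)
                 (↭-insert t₁ (t₂ ++ t₃) (applyUpTo suc N) e (entries-↭ N t))) ,
       RowIncreasing-∷ʳ μ₁ t₁ e inc₁ (λ v v∈ → s≤s (entries-≤ N t v (∈-++⁺ˡ v∈))) , inc₂ , inc₃ ,
       ColIncreasing-∷ʳᵘ μ₁ t₁ e μ₂ t₂ col₁₂ (subst₂ _≤_ (sym (row-end t₂ len₂ μ₂≤b)) (sym (row-end t₁ len₁ μ₁≤a)) b≤a) ,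
       col₂₃)
      where
      e = suc N
      total′ : suc a + b + c ≡ μ₁ + μ₂ + suc N
      total′ = trans (cong suc total) (total-suc N)

    grow₂-isTableau : ∀ N x → IsTableau N x → part₂ x < part₁ x → IsTableau (suc N) (grow₂ (suc N) x)
    grow₂-isTableau N x@((a , b , c) , (t₁ , t₂ , t₃))
      t@((b≤a , c≤b , total , μ₁≤a , μ₂≤b) , (len₁ , len₂ , len₃ , _ , inc₁ , inc₂ , inc₃ , col₁₂ , col₂₃)) b<a =
      (b<a , ≤-trans c≤b (n≤1+n b) , total′ , μ₁≤a , ≤-trans μ₂≤b (n≤1+n b)) ,
      (len₁ , trans (length-∷ʳ t₂ e) (trans (cong suc len₂) (sym (+-∸-assoc 1 μ₂≤b))) , len₃ ,
       entries-↭-size (suc N) (t₁ ++ (t₂ ++ e ∷ []) ++ t₃) μ₁≤a (≤-trans μ₂≤b (n≤1+n b)) total′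
         (subst₂ _↭_ regroup (applyUpTo-∷ʳ suc N)
                 (↭-insert (t₁ ++ t₂) t₃ (applyUpTo suc N) e
                           (subst (_↭ applyUpTo suc N) (sym (++-assoc t₁ t₂ t₃)) (entries-↭ N t)))) ,
       inc₁ , RowIncreasing-∷ʳ μ₂ t₂ e inc₂ (λ v v∈ → s≤s (entries-≤ N t v (∈-++⁺ʳ t₁ (∈-++⁺ˡ v∈)))) , inc₃ ,
       ColIncreasing-∷ʳₗ μ₁ t₁ μ₂ t₂ e col₁₂ (λ v v∈ → s≤s (entries-≤ N t v (∈-++⁺ˡ v∈))) ,
       ColIncreasing-∷ʳᵘ μ₂ t₂ e 0 t₃ col₂₃ (subst₂ _≤_ (sym len₃) (sym (row-end t₂ len₂ μ₂≤b)) c≤b))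
      where
      e = suc N
      total′ : a + suc b + c ≡ μ₁ + μ₂ + suc N
      total′ = trans (cong (_+ c) (+-suc a b)) (trans (cong suc total) (total-suc N))
      regroup : (t₁ ++ t₂) ++ e ∷ t₃ ≡ t₁ ++ (t₂ ++ e ∷ []) ++ t₃
      regroup = trans (++-assoc t₁ t₂ (e ∷ t₃)) (cong (t₁ ++_) (sym (++-assoc t₂ (e ∷ []) t₃)))

    grow₃-isTableau : ∀ N x → IsTableau N x → part₃ x < part₂ x → IsTableau (suc N) (grow₃ (suc N) x)
    grow₃-isTableau N x@((a , b , c) , (t₁ , t₂ , t₃))
      t@((b≤a , c≤b , total , μ₁≤a , μ₂≤b) , (len₁ , len₂ , len₃ , _ , inc₁ , inc₂ , inc₃ , col₁₂ , col₂₃)) c<b =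
      (b≤a , c<b , total′ , μ₁≤a , μ₂≤b) ,
      (len₁ , len₂ , trans (length-∷ʳ t₃ e) (cong suc len₃) ,
       entries-↭-size (suc N) (t₁ ++ t₂ ++ (t₃ ++ e ∷ [])) μ₁≤a μ₂≤b total′
         (subst₂ _↭_ regroup (applyUpTo-∷ʳ suc N)
                 (↭-insert (t₁ ++ t₂ ++ t₃) [] (applyUpTo suc N) e
                           (subst (_↭ applyUpTo suc N) (sym (++-identityʳ (t₁ ++ t₂ ++ t₃))) (entries-↭ N t)))) ,
       inc₁ , inc₂ , RowIncreasing-∷ʳ 0 t₃ e inc₃ (λ v v∈ → s≤s (entries-≤ N t v (∈-++⁺ʳ t₁ (∈-++⁺ʳ t₂ v∈)))) ,
       col₁₂ ,
       ColIncreasing-∷ʳₗ μ₂ t₂ 0 t₃ e col₂₃ (λ v v∈ → s≤s (entries-≤ N t v (∈-++⁺ʳ t₁ (∈-++⁺ˡ v∈)))))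
      where
      e = suc N
      total′ : a + b + suc c ≡ μ₁ + μ₂ + suc N
      total′ = trans (+-suc (a + b) c) (trans (cong suc total) (total-suc N))
      regroup : (t₁ ++ t₂ ++ t₃) ++ e ∷ [] ≡ t₁ ++ t₂ ++ (t₃ ++ e ∷ [])
      regroup = trans (++-assoc t₁ (t₂ ++ t₃) (e ∷ [])) (cong (t₁ ++_) (++-assoc t₂ t₃ (e ∷ [])))

    tableaux-sound : ∀ N {x} → x ∈ tableaux N → IsTableau N x
    tableaux-sound zero    (here refl) = start-isTableau
    tableaux-sound (suc N) z∈ with ∈-concatMap⁻ (extensions (suc N)) (tableaux N) z∈
    ... | x@((a , b , c) , (t₁ , t₂ , t₃)) , x∈ , z∈ext with ∈-extensions⁻ (suc N) a b c t₁ t₂ t₃ z∈ext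
    ...   | inj₁ refl                 = grow₁-isTableau N x (tableaux-sound N x∈)
    ...   | inj₂ (inj₁ (refl , b<a))  = grow₂-isTableau N x (tableaux-sound N x∈) b<a
    ...   | inj₂ (inj₂ (refl , c<b))  = grow₃-isTableau N x (tableaux-sound N x∈) c<b

    part-suc : ∀ {μ a} (t : List ℕ) e → length (t ++ e ∷ []) ≡ a ∸ μ → ∃ λ a′ → a ≡ suc a′
    part-suc {μ} {zero}   t e len = ⊥-elim (1+n≢0 (trans (sym (length-∷ʳ t e)) (trans len (0∸n≡0 μ))))
    part-suc {a = suc a′} t e len = a′ , refl

    row-shrink : ∀ {μ a} (t : List ℕ) e → length (t ++ e ∷ []) ≡ suc a ∸ μ → μ ≤ suc a → μ ≤ a × length t ≡ a ∸ μ
    row-shrink {μ} {a} t e len μ≤1+a with m≤n⇒m<n∨m≡n μ≤1+a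
    ... | inj₁ (s≤s μ≤a) = μ≤a , suc-injective (trans (sym (length-∷ʳ t e)) (trans len (+-∸-assoc 1 μ≤a)))
    ... | inj₂ refl      = ⊥-elim (1+n≢0 (trans (sym (length-∷ʳ t e)) (trans len (n∸n≡0 (suc a)))))

    last-not-below : ∀ o₁ t₁ e o₂ t₂ → ColIncreasing o₁ (t₁ ++ e ∷ []) o₂ t₂ → o₂ ≤ o₁ + length t₁ →
      o₁ + length t₁ < o₂ + length t₂ → (∀ v → v ∈ t₂ → v ≤ e) → ⊥
    last-not-below o₁ t₁ e o₂ t₂ col o₂≤end end<end₂ ≤e with entry-defined o₂ t₂ (o₁ + length t₁ ∸ o₂) below-end
      where
      below-end : o₁ + length t₁ ∸ o₂ < length t₂
      below-end = +-cancelˡ-< o₂ _ _ (subst (_< o₂ + length t₂) (sym (m+[n∸m]≡n o₂≤end)) end<end₂)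
    ... | z , z-entry , z∈ =
      <⇒≱ (col (o₁ + length t₁) e z (entry-last o₁ t₁ e) (subst (λ i → entry o₂ t₂ i ≡ just z) (m+[n∸m]≡n o₂≤end) z-entry))
          (≤e z z∈)

    shrink₁-isTableau : ∀ N x → IsTableau (suc N) (grow₁ (suc N) x) → IsTableau N x
    shrink₁-isTableau N x@((a , b , c) , (t₁ , t₂ , t₃))
      t@((b≤1+a , c≤b , total , μ₁≤1+a , μ₂≤b) , (len₁ , len₂ , len₃ , _ , inc₁ , inc₂ , inc₃ , col₁₂ , col₂₃))
      with row-shrink t₁ (suc N) len₁ μ₁≤1+a
    ... | μ₁≤a , len₁′ =
      (b≤a , c≤b , total′ , μ₁≤a , μ₂≤b) ,
      (len₁′ , len₂ , len₃ ,
       entries-↭-size N (t₁ ++ t₂ ++ t₃) μ₁≤a μ₂≤b total′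
         (↭-remove t₁ (t₂ ++ t₃) (applyUpTo suc N) e
           (subst₂ _↭_ (++-assoc t₁ (e ∷ []) (t₂ ++ t₃)) (sym (applyUpTo-∷ʳ suc N)) (entries-↭ (suc N) t))) ,
       RowIncreasing-++ˡ μ₁ t₁ (e ∷ []) inc₁ , inc₂ , inc₃ , ColIncreasing-++ᵘ μ₁ t₁ (e ∷ []) μ₂ t₂ col₁₂ , col₂₃)
      where
      e = suc N
      total′ : a + b + c ≡ μ₁ + μ₂ + N
      total′ = suc-injective (trans total (sym (total-suc N)))
      b≤a : b ≤ a
      b≤a with m≤n⇒m<n∨m≡n b≤1+a
      ... | inj₁ (s≤s b≤a) = b≤a
      ... | inj₂ refl      =
        ⊥-elim (last-not-below μ₁ t₁ e μ₂ t₂ col₁₂ (subst (μ₂ ≤_) (sym (row-end t₁ len₁′ μ₁≤a)) (≤-trans μ₂≤μ₁ μ₁≤a))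
                  (subst₂ _<_ (sym (row-end t₁ len₁′ μ₁≤a)) (sym (row-end t₂ len₂ μ₂≤b)) ≤-refl)
                  (λ v v∈ → entries-≤ (suc N) t v (∈-++⁺ʳ (t₁ ++ e ∷ []) (∈-++⁺ˡ v∈))))

    shrink₂-isTableau : ∀ N x → IsTableau (suc N) (grow₂ (suc N) x) → IsTableau N x
    shrink₂-isTableau N x@((a , b , c) , (t₁ , t₂ , t₃))
      t@((1+b≤a , c≤1+b , total , μ₁≤a , μ₂≤1+b) , (len₁ , len₂ , len₃ , _ , inc₁ , inc₂ , inc₃ , col₁₂ , col₂₃))
      with row-shrink t₂ (suc N) len₂ μ₂≤1+b
    ... | μ₂≤b , len₂′ =
      (≤-trans (n≤1+n b) 1+b≤a , c≤b , total′ , μ₁≤a , μ₂≤b) ,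
      (len₁ , len₂′ , len₃ ,
       entries-↭-size N (t₁ ++ t₂ ++ t₃) μ₁≤a μ₂≤b total′
         (subst (_↭ applyUpTo suc N) (++-assoc t₁ t₂ t₃)
           (↭-remove (t₁ ++ t₂) t₃ (applyUpTo suc N) e
             (subst₂ _↭_ (sym regroup) (sym (applyUpTo-∷ʳ suc N)) (entries-↭ (suc N) t)))) ,
       inc₁ , RowIncreasing-++ˡ μ₂ t₂ (e ∷ []) inc₂ , inc₃ ,
       ColIncreasing-++ₗ μ₁ t₁ μ₂ t₂ (e ∷ []) col₁₂ , ColIncreasing-++ᵘ μ₂ t₂ (e ∷ []) 0 t₃ col₂₃)
      where
      e = suc N
      total′ : a + b + c ≡ μ₁ + μ₂ + N
      total′ = suc-injective (trans (sym (cong (_+ c) (+-suc a b))) (trans total (sym (total-suc N))))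
      regroup : (t₁ ++ t₂) ++ e ∷ t₃ ≡ t₁ ++ (t₂ ++ e ∷ []) ++ t₃
      regroup = trans (++-assoc t₁ t₂ (e ∷ t₃)) (cong (t₁ ++_) (sym (++-assoc t₂ (e ∷ []) t₃)))
      c≤b : c ≤ b
      c≤b with m≤n⇒m<n∨m≡n c≤1+b
      ... | inj₁ (s≤s c≤b) = c≤b
      ... | inj₂ refl      =
        ⊥-elim (last-not-below μ₂ t₂ e 0 t₃ col₂₃ z≤n
                  (subst₂ _<_ (sym (row-end t₂ len₂′ μ₂≤b)) (sym len₃) ≤-refl)
                  (λ v v∈ → entries-≤ (suc N) t v (∈-++⁺ʳ t₁ (∈-++⁺ʳ (t₂ ++ e ∷ []) v∈))))

    shrink₃-isTableau : ∀ N x → IsTableau (suc N) (grow₃ (suc N) x) → IsTableau N x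
    shrink₃-isTableau N x@((a , b , c) , (t₁ , t₂ , t₃))
      t@((b≤a , 1+c≤b , total , μ₁≤a , μ₂≤b) , (len₁ , len₂ , len₃ , _ , inc₁ , inc₂ , inc₃ , col₁₂ , col₂₃)) =
      (b≤a , ≤-trans (n≤1+n c) 1+c≤b , total′ , μ₁≤a , μ₂≤b) ,
      (len₁ , len₂ , suc-injective (trans (sym (length-∷ʳ t₃ e)) len₃) ,
       entries-↭-size N (t₁ ++ t₂ ++ t₃) μ₁≤a μ₂≤b total′
         (subst (_↭ applyUpTo suc N) (++-identityʳ (t₁ ++ t₂ ++ t₃))
           (↭-remove (t₁ ++ t₂ ++ t₃) [] (applyUpTo suc N) e
             (subst₂ _↭_ (sym regroup) (sym (applyUpTo-∷ʳ suc N)) (entries-↭ (suc N) t)))) ,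
       inc₁ , inc₂ , RowIncreasing-++ˡ 0 t₃ (e ∷ []) inc₃ , col₁₂ , ColIncreasing-++ₗ μ₂ t₂ 0 t₃ (e ∷ []) col₂₃)
      where
      e = suc N
      total′ : a + b + c ≡ μ₁ + μ₂ + N
      total′ = suc-injective (trans (sym (+-suc (a + b) c)) (trans total (sym (total-suc N))))
      regroup : (t₁ ++ t₂ ++ t₃) ++ e ∷ [] ≡ t₁ ++ t₂ ++ (t₃ ++ e ∷ [])
      regroup = trans (++-assoc t₁ (t₂ ++ t₃) (e ∷ [])) (cong (t₁ ++_) (++-assoc t₂ t₃ (e ∷ [])))

    tableaux-complete-zero : ∀ x → IsTableau 0 x → x ∈ tableaux 0
    tableaux-complete-zero ((a , b , c) , (t₁ , t₂ , t₃)) ((_ , _ , total , μ₁≤a , μ₂≤b) , (len₁ , len₂ , len₃ , _)) =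
      here (cong₂ _,_ (cong₂ _,_ a≡μ₁ (cong₂ _,_ b≡μ₂ c≡0))
                      (cong₂ _,_ (empty t₁ (trans len₁ a∸μ₁≡0)) (cong₂ _,_ (empty t₂ (trans len₂ b∸μ₂≡0)) (empty t₃ (trans len₃ c≡0)))))
      where
      size≡0 = skewSize μ₁≤a μ₂≤b total
      a∸μ₁≡0 : a ∸ μ₁ ≡ 0
      a∸μ₁≡0 = m+n≡0⇒m≡0 (a ∸ μ₁) (m+n≡0⇒m≡0 ((a ∸ μ₁) + (b ∸ μ₂)) size≡0)
      b∸μ₂≡0 : b ∸ μ₂ ≡ 0
      b∸μ₂≡0 = m+n≡0⇒n≡0 (a ∸ μ₁) (m+n≡0⇒m≡0 ((a ∸ μ₁) + (b ∸ μ₂)) size≡0)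
      c≡0 : c ≡ 0
      c≡0 = m+n≡0⇒n≡0 ((a ∸ μ₁) + (b ∸ μ₂)) size≡0
      a≡μ₁ : a ≡ μ₁
      a≡μ₁ = ≤-antisym (m∸n≡0⇒m≤n a∸μ₁≡0) μ₁≤a
      b≡μ₂ : b ≡ μ₂
      b≡μ₂ = ≤-antisym (m∸n≡0⇒m≤n b∸μ₂≡0) μ₂≤b
      empty : ∀ (t : List ℕ) → length t ≡ 0 → t ≡ []
      empty [] _ = refl

    tableaux-complete : ∀ N x → IsTableau N x → x ∈ tableaux N
    tableaux-complete zero    x t = tableaux-complete-zero x t
    tableaux-complete (suc N) x@((a , b , c) , (t₁ , t₂ , t₃))
      t@((b≤a , c≤b , _ , _ , _) , (len₁ , len₂ , len₃ , _ , inc₁ , inc₂ , inc₃ , _ , _))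
      with ∈-++⁻ t₁ (∈-resp-↭ (↭-sym (entries-↭ (suc N) t)) (last-∈-applyUpTo N))
    ... | inj₁ e∈t₁
      with maximum-is-last t₁ (suc N) (RowIncreasing⇒Increasing μ₁ t₁ inc₁)
             (λ v v∈ → entries-≤ (suc N) t v (∈-++⁺ˡ v∈)) e∈t₁
    ...   | t₁′ , refl with part-suc {μ₁} {a} t₁′ (suc N) len₁
    ...     | a′ , refl =
      ∈-concatMap⁺ (extensions (suc N)) (tableaux N) (tableaux-complete N _ (shrink₁-isTableau N _ t)) (here refl)
    tableaux-complete (suc N) x@((a , b , c) , (t₁ , t₂ , t₃))
      t@((b≤a , c≤b , _ , _ , _) , (len₁ , len₂ , len₃ , _ , inc₁ , inc₂ , inc₃ , _ , _))
      | inj₂ e∈t₂t₃ with ∈-++⁻ t₂ e∈t₂t₃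
    ... | inj₁ e∈t₂
      with maximum-is-last t₂ (suc N) (RowIncreasing⇒Increasing μ₂ t₂ inc₂)
             (λ v v∈ → entries-≤ (suc N) t v (∈-++⁺ʳ t₁ (∈-++⁺ˡ v∈))) e∈t₂
    ...   | t₂′ , refl with part-suc {μ₂} {b} t₂′ (suc N) len₂
    ...     | b′ , refl =
      ∈-concatMap⁺ (extensions (suc N)) (tableaux N) (tableaux-complete N _ (shrink₂-isTableau N _ t))
        (there (∈-++⁺ˡ (∈-optional⁺ (b′ <? a) _ b≤a)))
    tableaux-complete (suc N) x@((a , b , c) , (t₁ , t₂ , t₃))
      t@((b≤a , c≤b , _ , _ , _) , (len₁ , len₂ , len₃ , _ , inc₁ , inc₂ , inc₃ , _ , _))
      | inj₂ _ | inj₂ e∈t₃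
      with maximum-is-last t₃ (suc N) (RowIncreasing⇒Increasing 0 t₃ inc₃)
             (λ v v∈ → entries-≤ (suc N) t v (∈-++⁺ʳ t₁ (∈-++⁺ʳ t₂ v∈))) e∈t₃
    ...   | t₃′ , refl with part-suc {0} {c} t₃′ (suc N) len₃
    ...     | c′ , refl =
      ∈-concatMap⁺ (extensions (suc N)) (tableaux N) (tableaux-complete N _ (shrink₃-isTableau N _ t))
        (there (∈-++⁺ʳ (optional (b <? a) _) (∈-optional⁺ (c′ <? b) _ c≤b)))

    tableau-fresh : ∀ N {y} → IsTableau N y → suc N ∈ entries y → ⊥
    tableau-fresh N t e∈ = 1+n≰n (entries-≤ N t (suc N) e∈)

    extensions-disjoint : ∀ N {x y z} → IsTableau N x → IsTableau N y →
      z ∈ extensions (suc N) x → z ∈ extensions (suc N) y → x ≡ y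
    extensions-disjoint N {x@((a , b , c) , (t₁ , t₂ , t₃))} {y@((a′ , b′ , c′) , (t₁′ , t₂′ , t₃′))} tx ty z∈x z∈y
      with ∈-extensions⁻ (suc N) a b c t₁ t₂ t₃ z∈x | ∈-extensions⁻ (suc N) a′ b′ c′ t₁′ t₂′ t₃′ z∈y
    ... | inj₁ refl               | inj₁ eq               = grow₁-injective (suc N) x y eq
    ... | inj₂ (inj₁ (refl , _))  | inj₂ (inj₁ (eq , _))  = grow₂-injective (suc N) x y eq
    ... | inj₂ (inj₂ (refl , _))  | inj₂ (inj₂ (eq , _))  = grow₃-injective (suc N) x y eq
    ... | inj₁ refl               | inj₂ (inj₁ (eq , _))  = ⊥-elim (tableau-fresh N ty (∈-++⁺ˡ (∈-∷ʳ-≡ t₁ (cong row₁ eq))))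
    ... | inj₁ refl               | inj₂ (inj₂ (eq , _))  = ⊥-elim (tableau-fresh N ty (∈-++⁺ˡ (∈-∷ʳ-≡ t₁ (cong row₁ eq))))
    ... | inj₂ (inj₁ (refl , _))  | inj₁ eq               = ⊥-elim (tableau-fresh N ty (∈-++⁺ʳ t₁′ (∈-++⁺ˡ (∈-∷ʳ-≡ t₂ (cong row₂ eq)))))
    ... | inj₂ (inj₁ (refl , _))  | inj₂ (inj₂ (eq , _))  = ⊥-elim (tableau-fresh N ty (∈-++⁺ʳ t₁′ (∈-++⁺ˡ (∈-∷ʳ-≡ t₂ (cong row₂ eq)))))
    ... | inj₂ (inj₂ (refl , _))  | inj₁ eq               = ⊥-elim (tableau-fresh N ty (∈-++⁺ʳ t₁′ (∈-++⁺ʳ t₂′ (∈-∷ʳ-≡ t₃ (cong row₃ eq)))))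
    ... | inj₂ (inj₂ (refl , _))  | inj₂ (inj₁ (eq , _))  = ⊥-elim (tableau-fresh N ty (∈-++⁺ʳ t₁′ (∈-++⁺ʳ t₂′ (∈-∷ʳ-≡ t₃ (cong row₃ eq)))))

    extensions-unique : ∀ e x → Unique (extensions e x)
    extensions-unique e x@((a , b , c) , _) with b <? a | c <? b
    ... | yes _ | yes _ = (grow₁≢grow₂ e x ∷ grow₁≢grow₃ e x ∷ []) ∷ (grow₂≢grow₃ e x ∷ []) ∷ [] ∷ []
    ... | yes _ | no _  = (grow₁≢grow₂ e x ∷ []) ∷ [] ∷ []
    ... | no _  | yes _ = (grow₁≢grow₃ e x ∷ []) ∷ [] ∷ []
    ... | no _  | no _  = [] ∷ []

    tableaux-unique : ∀ N → Unique (tableaux N)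
    tableaux-unique zero    = [] ∷ []
    tableaux-unique (suc N) =
      Unique-concatMap (extensions (suc N)) (tableaux N) (tableaux-unique N) (λ x _ → extensions-unique (suc N) x)
        (λ x∈ y∈ → extensions-disjoint N (tableaux-sound N x∈) (tableaux-sound N y∈))

    sum-completions-tableaux : ∀ N K → sum (map (completions K ∘ proj₁) (tableaux N)) ≡ completions (N + K) (μ₁ , μ₂ , 0)
    sum-completions-tableaux zero    K = +-identityʳ _
    sum-completions-tableaux (suc N) K = begin
      sum (map (completions K ∘ proj₁) (concatMap (extensions (suc N)) (tableaux N)))
        ≡⟨ sum-map-concatMap (completions K ∘ proj₁) (extensions (suc N)) (tableaux N) ⟩
      sum (map (λ x → sum (map (completions K ∘ proj₁) (extensions (suc N) x))) (tableaux N))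
        ≡⟨ sum-map-cong (tableaux N) (sum-completions-extensions (suc N) K) ⟩
      sum (map (completions (suc K) ∘ proj₁) (tableaux N))
        ≡⟨ sum-completions-tableaux N (suc K) ⟩
      completions (N + suc K) (μ₁ , μ₂ , 0)
        ≡⟨ cong (λ m → completions m (μ₁ , μ₂ , 0)) (+-suc N K) ⟩
      completions (suc N + K) (μ₁ , μ₂ , 0) ∎
      where open ≡-Reasoning

    length-tableaux : ∀ N → length (tableaux N) ≡ completions N (μ₁ , μ₂ , 0)
    length-tableaux N =
      trans (length≡sum-map-1 (tableaux N))
            (trans (sum-completions-tableaux N 0) (cong (λ m → completions m (μ₁ , μ₂ , 0)) (+-identityʳ N)))

    tableaux-count : ∀ N → HasCount (IsTableau N) (completions N (μ₁ , μ₂ , 0))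
    tableaux-count N =
      tableaux N , tableaux-unique N , tabulate (tableaux-sound N) , tableaux-complete N , length-tableaux N

module TableauMoments where

  open import Data.Nat as ℕ using (ℕ; zero; suc; _∸_; _≤_; _<?_)
  open import Data.Nat.Properties using (≤-trans; n≤1+n; +-∸-assoc; ≤-antisym; ≮⇒≥; n∸n≡0)
  open import Data.Integer using (+_; _+_)
  open import Data.Integer.Properties using (pos-+; +-assoc)
  open import Data.Product using (_,_)
  open import Relation.Nullary using (yes; no)
  open import Relation.Binary.PropositionalEquality
  open import Defs
  open MotzkinMoments
  open SkewTableaux
  open Moments motzkinMoment

  CompletionsMatch : ℕ → Set
  CompletionsMatch K = ∀ a b c → c ≤ b → b ≤ a → + completions K (a , b , c) ≡ Λ K (rjk (suc (b ∸ c)) (suc (a ∸ b)))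

  completions-row₁ : ∀ K → CompletionsMatch K → ∀ a b c → c ≤ b → b ≤ a →
    + completions K (suc a , b , c) ≡ Λ K (rjk (suc (b ∸ c)) (2 ℕ.+ (a ∸ b)))
  completions-row₁ K match a b c c≤b b≤a =
    trans (match (suc a) b c c≤b (≤-trans b≤a (n≤1+n a))) (cong (λ k → Λ K (rjk (suc (b ∸ c)) (suc k))) (+-∸-assoc 1 b≤a))

  completions-row₂ : ∀ K → CompletionsMatch K → ∀ a b c → c ≤ b → b ≤ a →
    + ifᵈ (b <? a) (completions K (a , suc b , c)) ≡ Λ K (rjk (2 ℕ.+ (b ∸ c)) (a ∸ b))
  completions-row₂ K match a b c c≤b b≤a with b <? a
  ... | yes b<a = trans (match a (suc b) c (≤-trans c≤b (n≤1+n b)) b<a)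
                        (cong₂ (λ j k → Λ K (rjk (suc j) k)) (+-∸-assoc 1 c≤b) (sym (+-∸-assoc 1 b<a)))
  ... | no b≮a  = sym (cong (λ k → Λ K (rjk (2 ℕ.+ (b ∸ c)) k)) (trans (cong (_∸ b) (≤-antisym (≮⇒≥ b≮a) b≤a)) (n∸n≡0 b)))

  completions-row₃ : ∀ K → CompletionsMatch K → ∀ a b c → c ≤ b → b ≤ a →
    + ifᵈ (c <? b) (completions K (a , b , suc c)) ≡ Λ K (rjk (b ∸ c) (suc (a ∸ b)))
  completions-row₃ K match a b c c≤b b≤a with c <? b
  ... | yes c<b = trans (match a b (suc c) c<b b≤a) (cong (λ j → Λ K (rjk j (suc (a ∸ b)))) (sym (+-∸-assoc 1 c<b)))
  ... | no c≮b  = sym (cong (λ j → Λ K (rjk j (suc (a ∸ b)))) (trans (cong (_∸ c) (≤-antisym (≮⇒≥ c≮b) c≤b)) (n∸n≡0 c)))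

  completions-match-suc : ∀ K → CompletionsMatch K → CompletionsMatch (suc K)
  completions-match-suc K match a b c c≤b b≤a = begin
    + (completions K (suc a , b , c) ℕ.+ (ifᵈ (b <? a) (completions K (a , suc b , c)) ℕ.+ ifᵈ (c <? b) (completions K (a , b , suc c))))
      ≡⟨ trans (pos-+ (completions K (suc a , b , c)) _)
               (cong (λ x → + completions K (suc a , b , c) + x) (pos-+ (ifᵈ (b <? a) _) _)) ⟩
    + completions K (suc a , b , c) + (+ ifᵈ (b <? a) (completions K (a , suc b , c)) + + ifᵈ (c <? b) (completions K (a , b , suc c)))
      ≡⟨ cong₂ _+_ (completions-row₁ K match a b c c≤b b≤a)
                   (cong₂ _+_ (completions-row₂ K match a b c c≤b b≤a) (completions-row₃ K match a b c c≤b b≤a)) ⟩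
    Λ K (rjk (suc (b ∸ c)) (2 ℕ.+ (a ∸ b))) + (Λ K (rjk (2 ℕ.+ (b ∸ c)) (a ∸ b)) + Λ K (rjk (b ∸ c) (suc (a ∸ b))))
      ≡⟨ sym (trans (Λ-rjk-shift K (b ∸ c) (a ∸ b))
                    (+-assoc (Λ K (rjk (suc (b ∸ c)) (2 ℕ.+ (a ∸ b)))) (Λ K (rjk (2 ℕ.+ (b ∸ c)) (a ∸ b)))
                             (Λ K (rjk (b ∸ c) (suc (a ∸ b)))))) ⟩
    Λ (suc K) (rjk (suc (b ∸ c)) (suc (a ∸ b))) ∎
    where open ≡-Reasoning

  completions≡Λ : ∀ K → CompletionsMatch K
  completions≡Λ zero    a b c _ _ = sym (Λ-rjk-zero (b ∸ c) (a ∸ b))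
  completions≡Λ (suc K) = completions-match-suc K (completions≡Λ K)

open import Defs
open import Data.Nat using (ℕ; suc; _+_; _∸_; _≤_; _≥_; z≤n)
open import Data.Nat.Properties using (m+[n∸m]≡n)
open import Data.Integer using (+_)
open import Data.Product using (Σ; _×_; _,_)
open import Relation.Binary.PropositionalEquality using (_≡_; subst; trans; sym)
open MotzkinMoments using (motzkinCombination≡Λ)
open SkewTableaux using (completions; module Tableaux)
open TableauMoments using (completions≡Λ)

theorem2p2 : (μ₁ μ₂ n : ℕ) → 1 ≤ μ₂ → μ₂ ≤ μ₁ → n ≥ μ₁ + μ₂ →
    Σ ℕ λ m → HasCount (SkewSYT3 μ₁ μ₂ n) m ×
      + m ≡ motzkinCombination (suc μ₂) (suc (μ₁ ∸ μ₂)) (n ∸ (μ₁ + μ₂))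
theorem2p2 μ₁ μ₂ n _ μ₂≤μ₁ n≥μ₁+μ₂ =
  completions N (μ₁ , μ₂ , 0) ,
  subst (λ n′ → HasCount (SkewSYT3 μ₁ μ₂ n′) (completions N (μ₁ , μ₂ , 0))) (m+[n∸m]≡n n≥μ₁+μ₂) (tableaux-count N) ,
  trans (completions≡Λ N μ₁ μ₂ 0 z≤n μ₂≤μ₁) (sym (motzkinCombination≡Λ (suc μ₂) (suc (μ₁ ∸ μ₂)) N))
  where
  N = n ∸ (μ₁ + μ₂)
  open Tableaux μ₁ μ₂ μ₂≤μ₁ using (tableaux-count)
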